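{- Let $q$ be even and $n\geq 2$, and let $\mathcal{H}^\pm$ be a non-empty set of hyperplanes of $\mathrm{PG}(2n,q)$ such that every point of $\mathrm{PG}(2n,q)$ lies in exactly $0$, $\tfrac12 q^{2n-1}$ or $\tfrac12 q^{n}(q^{n-1}\pm 1)$ hyperplanes of $\mathcal{H}^\pm$. Then $\mathsf{h}^\pm := |\mathcal{H}^\pm|/(\tfrac12 q^n)$ is an integer, and $\mathsf{h}^\pm$ is congruent to $0$ or to $\pm 1$ modulo $q^{n-1}$.
   Context: Sign convention: read all upper signs of $\pm$ throughout (hyperbolic case) or all lower signs throughout (elliptic case); two results are encoded. -}

module Defs where

open import Data.Nat as ℕ using (ℕ; zero; suc; _^_; _∸_)
open import Data.Nat.Divisibility using (_∣_)
open import Data.Fin using (Fin; zero; suc)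
open import Data.List using (List; []; _∷_; map; concatMap; filter; length; foldr)
open import Data.List.Base using (allFin)
open import Data.Bool using (Bool; true; false; _∧_; if_then_else_)
open import Data.Product using (∃; ∃-syntax; _×_)
open import Data.Sum using (_⊎_)
open import Data.Sign using (Sign)
open import Relation.Nullary using (does)
open import Relation.Binary.PropositionalEquality using (_≡_; _≢_)
open import Relation.Binary.Definitions using (DecidableEquality)
open import Algebra.Core using (Op₁; Op₂)
open import Algebra.Structures using (IsCommutativeRing)
open import Function.Bundles using (_↔_; Inverse)
import Data.Vec.Functional as VF
import Data.Bool as B

record FiniteField (q : ℕ) : Set₁ where
  field
    Carrier : Set
    _+_ : Op₂ Carrier
    _*_ : Op₂ Carrier
    -_  : Op₁ Carrier
    0#  : Carrier
    1#  : Carrier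
    isCommutativeRing : IsCommutativeRing _≡_ _+_ _*_ -_ 0# 1#
    0≢1 : 0# ≢ 1#
    inverse : ∀ x → x ≢ 0# → ∃[ y ] (x * y ≡ 1#)
    _≟_ : DecidableEquality Carrier
    enum : Fin q ↔ Carrier

-- The projective space PG(m, F) with points and hyperplanes given by
-- homogeneous coordinates in F^(m+1), normalised so that the first
-- nonzero coordinate equals 1 (a unique representative per point).
module PG {q : ℕ} (F : FiniteField q) (m : ℕ) where
  open FiniteField F

  Coords : ℕ → Set
  Coords k = Fin k → Carrier

  elements : List Carrier
  elements = map (Inverse.to enum) (allFin q)

  allVecs : (k : ℕ) → List (Coords k)
  allVecs zero = (λ ()) ∷ []
  allVecs (suc k) = concatMap (λ a → map (λ v → a VF.∷ v) (allVecs k)) elements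

  normalised : {k : ℕ} → Coords k → Bool
  normalised {zero} v = false
  normalised {suc k} v =
    if does (v zero ≟ 1#) then true
    else (if does (v zero ≟ 0#) then normalised (VF.tail v) else false)

  dot : {k : ℕ} → Coords k → Coords k → Carrier
  dot {zero} u v = 0#
  dot {suc k} u v = (u zero * v zero) + dot (VF.tail u) (VF.tail v)

  -- points (and, dually, hyperplanes) of PG(m, F)
  Point : Set
  Point = Coords (suc m)

  points : List Point
  points = filter (λ v → normalised v B.≟ true) (allVecs (suc m))

  -- the point x lies on the hyperplane with dual coordinates u
  incident : Point → Point → Bool
  incident u x = does (dot u x ≟ 0#)

  -- a set of hyperplanes is given by a Boolean predicate on the
  -- (normalised) dual coordinate vectors
  HyperplaneSet : Set
  HyperplaneSet = Point → Bool

  card : HyperplaneSet → ℕ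
  card H = length (filter (λ u → H u B.≟ true) points)

  through : HyperplaneSet → Point → ℕ
  through H x = length (filter (λ u → (H u ∧ incident u x) B.≟ true) points)

secantValue : Sign → ℕ → ℕ → ℕ
secantValue Sign.+ q n = q ^ n ℕ.* (q ^ (n ∸ 1) ℕ.+ 1)
secantValue Sign.- q n = q ^ n ℕ.* (q ^ (n ∸ 1) ∸ 1)

≡±1-mod : Sign → ℕ → ℕ → Set
≡±1-mod Sign.+ h Q = ∃[ k ] (h ≡ k ℕ.* Q ℕ.+ 1)
≡±1-mod Sign.- h Q = Q ∣ h ℕ.+ 1

{-# OPTIONS --safe #-}
module Submission where

-- Let t x be the number of hyperplanes of H through the point x and θ k = 1 + q + ⋯ + q ^ (k - 1).
-- Counting incident pairs and triples gives the standard equations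
--   Σ t = |H| θ (2n)   and   Σ t² = |H|² θ (2n - 1) + q ^ (2n - 1) |H|.
-- By hypothesis 2 t x = q ^ n y x with y x ∈ {0, q ^ (n - 1), q ^ (n - 1) ± 1}. Since θ k ≡ 1 modulo q,
-- the first equation makes h = 2 |H| / q ^ n an integer, and the equations become
--   Σ y = h θ (2n)   and   Σ y² = h² θ (2n - 1) + 2 q ^ (n - 1) h.
-- Every admissible weight satisfies y² ≡ ± y modulo q ^ (n - 1), whence q ^ (n - 1) ∣ h (h ∓ 1) θ (2n - 1),
-- so q ^ (n - 1) ∣ h (h ∓ 1). A field of even order has characteristic 2, so q is a power of 2 and
-- q ^ (n - 1) divides one of the coprime factors h and h ∓ 1.

open import Algebra.Bundles using (CommutativeRing)
import Data.Nat.Properties as ℕₚ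
open import Algebra.Properties.CommutativeSemigroup ℕₚ.+-commutativeSemigroup
  using () renaming (interchange to +-interchange)
open import Algebra.Properties.CommutativeSemigroup ℕₚ.*-commutativeSemigroup
  using () renaming (x∙yz≈y∙xz to *-left-comm; interchange to *-interchange)
open import Data.Bool using (Bool; true; false; _∧_)
open import Data.Empty using (⊥; ⊥-elim)
open import Data.Fin using (Fin; zero; suc; toℕ)
import Data.Fin.Properties as Finₚ
open import Data.List using (List; []; _∷_; map; concatMap; filter; length; _++_; tabulate; allFin)
import Data.List.Properties as Listₚ
open import Data.Maybe using (nothing)
open import Data.Nat as ℕ using (ℕ; zero; suc)
open import Data.Nat.Divisibility using (_∣_)
open import Data.Product using (∃; _×_; _,_; proj₁; proj₂)
open import Data.Sign using (Sign)
open import Data.Sum using (_⊎_; inj₁; inj₂)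
open import Data.Vec.Functional using (tail) renaming (_∷_ to _∷ᵛ_)
open import Function using (_∘_; _⇔_; mk⇔; Equivalence; Inverse)
open import Level using (0ℓ)
open import Relation.Binary.PropositionalEquality
open import Relation.Nullary using (Dec; yes; no; does; ¬_)
open import Relation.Nullary.Decidable using (does-⇔; _→-dec_; _×-dec_)
open import Defs

module Sums where

  open import Data.Nat using (_+_; _*_; _≤_)

  ⟦_⟧ : Bool → ℕ
  ⟦ true ⟧ = 1
  ⟦ false ⟧ = 0

  ⟦∧⟧ : ∀ a b → ⟦ a ∧ b ⟧ ≡ ⟦ a ⟧ * ⟦ b ⟧
  ⟦∧⟧ true true = refl
  ⟦∧⟧ true false = refl
  ⟦∧⟧ false b = refl

  ⟦⟧-idem : ∀ a → ⟦ a ⟧ * ⟦ a ⟧ ≡ ⟦ a ⟧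
  ⟦⟧-idem true = refl
  ⟦⟧-idem false = refl

  ⟦⟧-≤1 : ∀ b → ⟦ b ⟧ ≤ 1
  ⟦⟧-≤1 true = ℕₚ.≤-refl
  ⟦⟧-≤1 false = ℕ.z≤n

  ∑ : {A : Set} → List A → (A → ℕ) → ℕ
  ∑ [] f = 0
  ∑ (x ∷ xs) f = f x + ∑ xs f

  module _ {A : Set} where

    ∑-cong : (L : List A) {f g : A → ℕ} → (∀ x → f x ≡ g x) → ∑ L f ≡ ∑ L g
    ∑-cong [] e = refl
    ∑-cong (x ∷ L) e = cong₂ _+_ (e x) (∑-cong L e)

    ∑-+ : (L : List A) (f g : A → ℕ) → ∑ L (λ x → f x + g x) ≡ ∑ L f + ∑ L g
    ∑-+ [] f g = refl
    ∑-+ (x ∷ L) f g = begin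
        f x + g x + ∑ L (λ x → f x + g x) ≡⟨ cong (f x + g x +_) (∑-+ L f g) ⟩
        f x + g x + (∑ L f + ∑ L g)       ≡⟨ +-interchange (f x) (g x) _ _ ⟩
        f x + ∑ L f + (g x + ∑ L g)       ∎
      where open ≡-Reasoning

    ∑-*ˡ : (L : List A) (c : ℕ) (f : A → ℕ) → ∑ L (λ x → c * f x) ≡ c * ∑ L f
    ∑-*ˡ [] c f = sym (ℕₚ.*-zeroʳ c)
    ∑-*ˡ (x ∷ L) c f = trans (cong (c * f x +_) (∑-*ˡ L c f)) (sym (ℕₚ.*-distribˡ-+ c (f x) _))

    ∑-const : (L : List A) (c : ℕ) → ∑ L (λ _ → c) ≡ length L * c
    ∑-const [] c = refl
    ∑-const (x ∷ L) c = cong (c +_) (∑-const L c)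

    ∑-zero : (L : List A) {f : A → ℕ} → (∀ x → f x ≡ 0) → ∑ L f ≡ 0
    ∑-zero L e = trans (∑-cong L e) (trans (∑-const L 0) (ℕₚ.*-zeroʳ (length L)))

    ∑-++ : (L M : List A) (f : A → ℕ) → ∑ (L ++ M) f ≡ ∑ L f + ∑ M f
    ∑-++ [] M f = refl
    ∑-++ (x ∷ L) M f = trans (cong (f x +_) (∑-++ L M f)) (sym (ℕₚ.+-assoc (f x) _ _))

    ∑-mono-≤ : (L : List A) {f g : A → ℕ} → (∀ x → f x ≤ g x) → ∑ L f ≤ ∑ L g
    ∑-mono-≤ [] e = ℕ.z≤n
    ∑-mono-≤ (x ∷ L) e = ℕₚ.+-mono-≤ (e x) (∑-mono-≤ L e)

    ∑-≡-mod : (L : List A) (f g : A → ℕ) (c : ℕ) → (∀ x → ∃ λ w → f x ≡ g x + c * w) →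
      ∃ λ W → ∑ L f ≡ ∑ L g + c * W
    ∑-≡-mod [] f g c pw = 0 , sym (ℕₚ.*-zeroʳ c)
    ∑-≡-mod (x ∷ L) f g c pw with pw x | ∑-≡-mod L f g c pw
    ... | w , e | W , E = w + W , (begin
        f x + ∑ L f                   ≡⟨ cong₂ _+_ e E ⟩
        g x + c * w + (∑ L g + c * W) ≡⟨ +-interchange (g x) (c * w) _ _ ⟩
        g x + ∑ L g + (c * w + c * W) ≡⟨ cong (g x + ∑ L g +_) (ℕₚ.*-distribˡ-+ c w W) ⟨
        g x + ∑ L g + c * (w + W)     ∎)
      where open ≡-Reasoning

    length-filter∘filter≡∑ : (L : List A) (Q P : A → Bool) →
      length (filter (λ x → P x Data.Bool.≟ true) (filter (λ x → Q x Data.Bool.≟ true) L))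
        ≡ ∑ L (λ x → ⟦ Q x ⟧ * ⟦ P x ⟧)
    length-filter∘filter≡∑ [] Q P = refl
    length-filter∘filter≡∑ (x ∷ L) Q P with Q x
    ... | false = length-filter∘filter≡∑ L Q P
    ... | true with P x
    ...   | true = cong suc (length-filter∘filter≡∑ L Q P)
    ...   | false = length-filter∘filter≡∑ L Q P

  module _ {A B : Set} where

    ∑-comm : (L : List A) (M : List B) (f : A → B → ℕ) →
      ∑ L (λ x → ∑ M (λ y → f x y)) ≡ ∑ M (λ y → ∑ L (λ x → f x y))
    ∑-comm [] M f = sym (∑-zero M (λ _ → refl))
    ∑-comm (x ∷ L) M f = trans (cong (∑ M (f x) +_) (∑-comm L M f)) (sym (∑-+ M (f x) _))

    ∑-map : (h : A → B) (L : List A) (f : B → ℕ) → ∑ (map h L) f ≡ ∑ L (f ∘ h)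
    ∑-map h [] f = refl
    ∑-map h (x ∷ L) f = cong (f (h x) +_) (∑-map h L f)

    ∑-concatMap : (g : A → List B) (L : List A) (f : B → ℕ) →
      ∑ (concatMap g L) f ≡ ∑ L (λ a → ∑ (g a) f)
    ∑-concatMap g [] f = refl
    ∑-concatMap g (x ∷ L) f = trans (∑-++ (g x) (concatMap g L) f) (cong (∑ (g x) f +_) (∑-concatMap g L f))

  ∑Fin : (n : ℕ) → (Fin n → ℕ) → ℕ
  ∑Fin zero f = 0
  ∑Fin (suc n) f = f zero + ∑Fin n (f ∘ suc)

  ∑-tabulate : ∀ {A : Set} n (h : Fin n → A) (f : A → ℕ) → ∑ (tabulate h) f ≡ ∑Fin n (f ∘ h)
  ∑-tabulate zero h f = refl
  ∑-tabulate (suc n) h f = cong (f (h zero) +_) (∑-tabulate n (h ∘ suc) f)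

  ∑Fin-cong : ∀ n {f g : Fin n → ℕ} → (∀ i → f i ≡ g i) → ∑Fin n f ≡ ∑Fin n g
  ∑Fin-cong zero e = refl
  ∑Fin-cong (suc n) e = cong₂ _+_ (e zero) (∑Fin-cong n (e ∘ suc))

  ∑Fin-zero : ∀ n {f : Fin n → ℕ} → (∀ i → f i ≡ 0) → ∑Fin n f ≡ 0
  ∑Fin-zero zero e = refl
  ∑Fin-zero (suc n) e = cong₂ _+_ (e zero) (∑Fin-zero n (e ∘ suc))

  ∑Fin-δ : ∀ n (j : Fin n) (g : Fin n → ℕ) → ∑Fin n (λ i → ⟦ does (j Finₚ.≟ i) ⟧ * g i) ≡ g j
  ∑Fin-δ (suc n) zero g =
    trans (cong₂ _+_ (ℕₚ.*-identityˡ (g zero)) (∑Fin-zero n (λ _ → refl))) (ℕₚ.+-identityʳ _)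
  ∑Fin-δ (suc n) (suc j) g =
    trans (∑Fin-cong n (λ i → cong (λ b → ⟦ b ⟧ * g (suc i))
            (does-⇔ (mk⇔ Finₚ.suc-injective (cong suc)) (suc j Finₚ.≟ suc i) (j Finₚ.≟ i))))
          (∑Fin-δ n j (g ∘ suc))

  ⟦does⟧*-cong : {P P′ Q : Set} (p : Dec P) (p′ : Dec P′) (r : Dec Q) →
    (P → Q → P′) → (P′ → Q → P) → ⟦ does p ⟧ * ⟦ does r ⟧ ≡ ⟦ does p′ ⟧ * ⟦ does r ⟧
  ⟦does⟧*-cong p p′ (yes r) f g = cong (λ b → ⟦ b ⟧ * 1) (does-⇔ (mk⇔ (λ x → f x r) (λ x → g x r)) p p′)
  ⟦does⟧*-cong p p′ (no _) f g = trans (ℕₚ.*-zeroʳ ⟦ does p ⟧) (sym (ℕₚ.*-zeroʳ ⟦ does p′ ⟧))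

  ⟦does⟧*-disjoint : {P Q : Set} (p : Dec P) (r : Dec Q) → (P → Q → ⊥) → ⟦ does p ⟧ * ⟦ does r ⟧ ≡ 0
  ⟦does⟧*-disjoint (yes p) (yes r) f = ⊥-elim (f p r)
  ⟦does⟧*-disjoint (yes _) (no _) f = refl
  ⟦does⟧*-disjoint (no _) r f = refl

  ⟦does⟧*-implied : {P Q : Set} (p : Dec P) (r : Dec Q) → (Q → P) → ⟦ does p ⟧ * ⟦ does r ⟧ ≡ ⟦ does r ⟧
  ⟦does⟧*-implied (yes _) r f = ℕₚ.*-identityˡ _
  ⟦does⟧*-implied (no ¬p) (yes r) f = ⊥-elim (¬p (f r))
  ⟦does⟧*-implied (no _) (no _) f = refl

open Sums

module Arithmetic where

  open import Data.Nat using (_+_; _*_; _^_; _∸_; _≤_; _<_; _<?_; s≤s; z≤n)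
  open import Data.Nat.Divisibility
  open import Data.Nat.Primality using (euclidsLemma; prime[2])
  open import Data.Nat.Coprimality using (Coprime; coprime-divisor)
  open import Data.Nat.Tactic.RingSolver using (solve)
  open import Relation.Binary.Definitions using (tri<; tri≈; tri>)
  open import Relation.Nullary.Decidable using (dec-true; dec-false)

  n<2^n : ∀ n → n < 2 ^ n
  n<2^n zero = s≤s z≤n
  n<2^n (suc n) = ℕₚ.+-mono-≤ (ℕₚ.≤-trans (s≤s z≤n) (n<2^n n)) (ℕₚ.≤-trans (n<2^n n) (ℕₚ.m≤m+n (2 ^ n) 0))

  ⟦<?⟧+⟦>?⟧≡1 : ∀ i j → i ≢ j → ⟦ does (i <? j) ⟧ + ⟦ does (j <? i) ⟧ ≡ 1
  ⟦<?⟧+⟦>?⟧≡1 i j i≢j with ℕₚ.<-cmp i j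
  ... | tri< i<j _ j≮i = cong₂ _+_ (cong ⟦_⟧ (dec-true (i <? j) i<j)) (cong ⟦_⟧ (dec-false (j <? i) j≮i))
  ... | tri≈ _ i≡j _ = ⊥-elim (i≢j i≡j)
  ... | tri> i≮j _ j<i = cong₂ _+_ (cong ⟦_⟧ (dec-false (i <? j) i≮j)) (cong ⟦_⟧ (dec-true (j <? i) j<i))

  ⟦<?⟧-irrefl : ∀ i → ⟦ does (i <? i) ⟧ ≡ 0
  ⟦<?⟧-irrefl i = cong ⟦_⟧ (dec-false (i <? i) (ℕₚ.<-irrefl refl))

  ¬2∣1 : ¬ (2 ∣ 1)
  ¬2∣1 d with ∣1⇒≡1 d
  ... | ()

  ¬2∣1+[k+k] : ∀ k → ¬ (2 ∣ 1 + (k + k))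
  ¬2∣1+[k+k] k d = ¬2∣1 (∣m+n∣m⇒∣n (subst (2 ∣_) (ℕₚ.+-comm 1 (k + k)) d) (divides k (solve (k ∷ []))))

  2^j∣*odd⇒2^j∣ : ∀ j b c → 2 ^ j ∣ b * c → ¬ (2 ∣ c) → 2 ^ j ∣ b
  2^j∣*odd⇒2^j∣ zero b c _ _ = 1∣ b
  2^j∣*odd⇒2^j∣ (suc j) b c d ¬2∣c with euclidsLemma b c prime[2] (∣-trans (m∣m*n (2 ^ j)) d)
  ... | inj₂ 2∣c = ⊥-elim (¬2∣c 2∣c)
  ... | inj₁ (divides b′ refl) = subst (2 ^ suc j ∣_) (ℕₚ.*-comm 2 b′) (*-monoʳ-∣ 2 2^j∣b′)
    where
    2^j∣b′ : 2 ^ j ∣ b′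
    2^j∣b′ = 2^j∣*odd⇒2^j∣ j b′ c (*-cancelˡ-∣ 2 (subst (2 * 2 ^ j ∣_) reassoc d)) ¬2∣c
      where
      reassoc : b′ * 2 * c ≡ 2 * (b′ * c)
      reassoc = solve (b′ ∷ c ∷ [])

  2^j∣consecutive : ∀ j a → 2 ^ j ∣ a * suc a → 2 ^ j ∣ a ⊎ 2 ^ j ∣ suc a
  2^j∣consecutive j a d with 2 ∣? a
  ... | yes 2∣a = inj₁ (2^j∣*odd⇒2^j∣ j a (suc a) d λ 2∣1+a →
                          ¬2∣1 (∣m+n∣m⇒∣n (subst (2 ∣_) (ℕₚ.+-comm 1 a) 2∣1+a) 2∣a))
  ... | no ¬2∣a = inj₂ (2^j∣*odd⇒2^j∣ j (suc a) a (subst (2 ^ j ∣_) (ℕₚ.*-comm a (suc a)) d) ¬2∣a)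

  p*t+1≡a*z⇒coprime : ∀ a t p z → p * t + 1 ≡ a * z → Coprime a t
  p*t+1≡a*z⇒coprime a t p z e {d} (d∣a , d∣t) =
    ∣1⇒≡1 (∣m+n∣m⇒∣n (subst (d ∣_) (sym e) (∣-trans d∣a (m∣m*n z))) (∣-trans d∣t (n∣m*n p)))

  -- Qₙ = q ^ n, Q = q ^ (n - 1), N = |H|, T = θ (2n - 1); Y₁ and Y₂ are the first two moments of the weights.
  moment-equations⇒h : ∀ Qₙ Q N Y₁ Y₂ T → .{{_ : ℕ.NonZero Qₙ}} → Coprime Qₙ (Qₙ * Q + T) →
    Qₙ * Y₁ ≡ 2 * (N * (Qₙ * Q + T)) →
    Qₙ * Qₙ * Y₂ ≡ 4 * (N * N * T + Qₙ * Q * N) →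
    ∃ λ h → (2 * N ≡ h * Qₙ) × (Y₁ ≡ h * (Qₙ * Q + T)) × (Y₂ ≡ h * h * T + 2 * Q * h)
  moment-equations⇒h Qₙ Q N Y₁ Y₂ T coprime e₁ e₂ with coprime-divisor coprime (divides Y₁ T₁*2N≡Y₁*Qₙ)
    where
    T₁*2N≡Y₁*Qₙ : (Qₙ * Q + T) * (2 * N) ≡ Y₁ * Qₙ
    T₁*2N≡Y₁*Qₙ = begin
      (Qₙ * Q + T) * (2 * N)   ≡⟨ solve (Qₙ ∷ Q ∷ T ∷ N ∷ []) ⟩
      2 * (N * (Qₙ * Q + T))   ≡⟨ e₁ ⟨
      Qₙ * Y₁                  ≡⟨ ℕₚ.*-comm Qₙ Y₁ ⟩
      Y₁ * Qₙ                  ∎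
      where open ≡-Reasoning
  ... | divides h 2N≡hQₙ = h , 2N≡hQₙ , Y₁≡ , Y₂≡
    where
    instance
      Qₙ²-nonZero : ℕ.NonZero (Qₙ * Qₙ)
      Qₙ²-nonZero = ℕₚ.m*n≢0 Qₙ Qₙ
    Y₁≡ : Y₁ ≡ h * (Qₙ * Q + T)
    Y₁≡ = ℕₚ.*-cancelˡ-≡ Y₁ _ Qₙ (begin
      Qₙ * Y₁                      ≡⟨ e₁ ⟩
      2 * (N * (Qₙ * Q + T))       ≡⟨ solve (N ∷ Qₙ ∷ Q ∷ T ∷ []) ⟩
      (2 * N) * (Qₙ * Q + T)       ≡⟨ cong (_* (Qₙ * Q + T)) 2N≡hQₙ ⟩
      h * Qₙ * (Qₙ * Q + T)        ≡⟨ solve (h ∷ Qₙ ∷ Q ∷ T ∷ []) ⟩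
      Qₙ * (h * (Qₙ * Q + T))      ∎)
      where open ≡-Reasoning
    Y₂≡ : Y₂ ≡ h * h * T + 2 * Q * h
    Y₂≡ = ℕₚ.*-cancelˡ-≡ Y₂ _ (Qₙ * Qₙ) (begin
      Qₙ * Qₙ * Y₂                                      ≡⟨ e₂ ⟩
      4 * (N * N * T + Qₙ * Q * N)                      ≡⟨ solve (N ∷ Qₙ ∷ Q ∷ T ∷ []) ⟩
      (2 * N) * (2 * N) * T + 2 * Qₙ * Q * (2 * N)      ≡⟨ cong (λ m → m * m * T + 2 * Qₙ * Q * m) 2N≡hQₙ ⟩
      h * Qₙ * (h * Qₙ) * T + 2 * Qₙ * Q * (h * Qₙ)    ≡⟨ solve (h ∷ Qₙ ∷ Q ∷ T ∷ []) ⟩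
      Qₙ * Qₙ * (h * h * T + 2 * Q * h)                 ∎)
      where open ≡-Reasoning

  ≡0∨≡1-mod : ∀ Q Qₙ h T W → (∀ a → Q ∣ a * suc a → Q ∣ a ⊎ Q ∣ suc a) → Coprime Q T →
    h * h * T + 2 * Q * h ≡ h * (Qₙ * Q + T) + Q * W → Q ∣ h ⊎ (∃ λ k → h ≡ k * Q + 1)
  ≡0∨≡1-mod Q Qₙ zero T W _ _ _ = inj₁ (divides 0 refl)
  ≡0∨≡1-mod Q Qₙ (suc h′) T W Q∣consecutive coprime e
    with Q∣consecutive h′ (coprime-divisor coprime (subst (Q ∣_) (ℕₚ.*-comm (h′ * suc h′) T) Q∣h′[h′+1]T))
    where
    -- subtracting h T from both sides leaves (h - 1) h T ≡ 0 modulo Q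
    cancelled : h′ * suc h′ * T + Q * (2 * suc h′) ≡ Q * (suc h′ * Qₙ + W)
    cancelled = ℕₚ.+-cancelˡ-≡ (suc h′ * T) _ _ (begin
      suc h′ * T + (h′ * suc h′ * T + Q * (2 * suc h′))   ≡⟨ solve (h′ ∷ T ∷ Q ∷ []) ⟩
      suc h′ * suc h′ * T + 2 * Q * suc h′                 ≡⟨ e ⟩
      suc h′ * (Qₙ * Q + T) + Q * W                        ≡⟨ solve (h′ ∷ Qₙ ∷ Q ∷ T ∷ W ∷ []) ⟩
      suc h′ * T + Q * (suc h′ * Qₙ + W)                   ∎)
      where open ≡-Reasoning
    Q∣h′[h′+1]T : Q ∣ h′ * suc h′ * T
    Q∣h′[h′+1]T = ∣m+n∣m⇒∣n
      (subst (Q ∣_) (trans (sym cancelled) (ℕₚ.+-comm (h′ * suc h′ * T) _)) (m∣m*n (suc h′ * Qₙ + W)))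
      (m∣m*n (2 * suc h′))
  ... | inj₁ (divides k refl) = inj₂ (k , ℕₚ.+-comm 1 (k * Q))
  ... | inj₂ Q∣h = inj₁ Q∣h

  ≡0∨≡-1-mod : ∀ Q Qₙ h T W → (∀ a → Q ∣ a * suc a → Q ∣ a ⊎ Q ∣ suc a) → Coprime Q T →
    h * h * T + 2 * Q * h + h * (Qₙ * Q + T) ≡ Q * W → Q ∣ h ⊎ Q ∣ h + 1
  ≡0∨≡-1-mod Q Qₙ h T W Q∣consecutive coprime e
    with Q∣consecutive h (coprime-divisor coprime (subst (Q ∣_) (ℕₚ.*-comm (h * suc h) T) Q∣h[h+1]T))
    where
    Q∣h[h+1]T : Q ∣ h * suc h * T
    Q∣h[h+1]T = ∣m+n∣m⇒∣n (subst (Q ∣_) regroup (m∣m*n W)) (m∣m*n (2 * h + h * Qₙ))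
      where
      regroup : Q * W ≡ Q * (2 * h + h * Qₙ) + h * suc h * T
      regroup = begin
        Q * W                                      ≡⟨ e ⟨
        h * h * T + 2 * Q * h + h * (Qₙ * Q + T)   ≡⟨ solve (h ∷ T ∷ Q ∷ Qₙ ∷ []) ⟩
        Q * (2 * h + h * Qₙ) + h * suc h * T       ∎
        where open ≡-Reasoning
  ... | inj₁ Q∣h = inj₁ Q∣h
  ... | inj₂ Q∣1+h = inj₂ (subst (Q ∣_) (ℕₚ.+-comm 1 h) Q∣1+h)

  m*m≡m+m*[m∸1] : ∀ m → m ≢ 0 → m * m ≡ m + m * (m ∸ 1)
  m*m≡m+m*[m∸1] zero m≢0 = ⊥-elim (m≢0 refl)
  m*m≡m+m*[m∸1] (suc r) _ = ℕₚ.*-suc (suc r) r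

  [m∸1]²+[m∸1]≡m*[m∸1] : ∀ m → m ≢ 0 → (m ∸ 1) * (m ∸ 1) + (m ∸ 1) ≡ 0 + m * (m ∸ 1)
  [m∸1]²+[m∸1]≡m*[m∸1] zero m≢0 = ⊥-elim (m≢0 refl)
  [m∸1]²+[m∸1]≡m*[m∸1] (suc r) _ = ℕₚ.+-comm (r * r) r

open Arithmetic

module Field {q : ℕ} (F : FiniteField q) where

  open import Data.Nat using (_≤_; _^_)
  open import Data.Bool using (T; _∨_)
  open import Data.Bool.Properties using (T-∨; T-≡)
  open import Relation.Nullary.Decidable using (T?; dec-true)

  open FiniteField F public using (Carrier)
  open FiniteField F using (isCommutativeRing; enum; inverse; 0≢1)

  infix 4 _≟_
  _≟_ : (x y : Carrier) → Dec (x ≡ y)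
  _≟_ = FiniteField._≟_ F

  ring : CommutativeRing 0ℓ 0ℓ
  ring = record { isCommutativeRing = isCommutativeRing }

  open CommutativeRing ring public
    using (_+_; _*_; -_; 0#; 1#; +-comm; +-assoc; *-comm; *-assoc; +-identityˡ; +-identityʳ;
           *-identityˡ; *-identityʳ; -‿inverseʳ; distribʳ; zeroˡ; zeroʳ)
  open import Algebra.Properties.Ring (CommutativeRing.ring ring) public using (-‿distribˡ-*)

  1≢0 : 1# ≢ 0#
  1≢0 e = 0≢1 (sym e)

  toC : Fin q → Carrier
  toC = Inverse.to enum

  fromC : Carrier → Fin q
  fromC = Inverse.from enum

  toC∘fromC : ∀ a → toC (fromC a) ≡ a
  toC∘fromC = Inverse.strictlyInverseˡ enum

  elements : List Carrier
  elements = map toC (allFin q)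

  ∑ᶠ : (Carrier → ℕ) → ℕ
  ∑ᶠ = ∑ elements

  ∑ᶠ-cong : {f g : Carrier → ℕ} → (∀ a → f a ≡ g a) → ∑ᶠ f ≡ ∑ᶠ g
  ∑ᶠ-cong = ∑-cong elements

  ∑ᶠ-const : ∀ k → ∑ᶠ (λ _ → k) ≡ q ℕ.* k
  ∑ᶠ-const k = trans (∑-const elements k)
    (cong (ℕ._* k) (trans (Listₚ.length-map toC (allFin q)) (Listₚ.length-tabulate {n = q} (λ i → i))))

  ∑ᶠ-δ : ∀ c (g : Carrier → ℕ) → ∑ᶠ (λ a → ⟦ does (c ≟ a) ⟧ ℕ.* g a) ≡ g c
  ∑ᶠ-δ c g = begin
      ∑ᶠ (λ a → ⟦ does (c ≟ a) ⟧ ℕ.* g a)                       ≡⟨ ∑-map toC (allFin q) _ ⟩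
      ∑ (allFin q) (λ i → ⟦ does (c ≟ toC i) ⟧ ℕ.* g (toC i))    ≡⟨ ∑-tabulate q (λ i → i) _ ⟩
      ∑Fin q (λ i → ⟦ does (c ≟ toC i) ⟧ ℕ.* g (toC i))          ≡⟨ ∑Fin-cong q (λ i → cong (λ b → ⟦ b ⟧ ℕ.* g (toC i))
                                                                     (does-⇔ c≡toC⇔ (c ≟ toC i) (fromC c Finₚ.≟ i))) ⟩
      ∑Fin q (λ i → ⟦ does (fromC c Finₚ.≟ i) ⟧ ℕ.* g (toC i))   ≡⟨ ∑Fin-δ q (fromC c) (g ∘ toC) ⟩
      g (toC (fromC c))                                        ≡⟨ cong g (toC∘fromC c) ⟩
      g c                                                      ∎
    where
    open ≡-Reasoning
    c≡toC⇔ : ∀ {i} → (c ≡ toC i) ⇔ (fromC c ≡ i)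
    c≡toC⇔ {i} = mk⇔ (λ e → trans (cong fromC e) (Inverse.strictlyInverseʳ enum i))
                     (λ e → trans (sym (toC∘fromC c)) (cong toC e))

  ∑ᶠ-δ′ : ∀ c (g : Carrier → ℕ) → ∑ᶠ (λ a → ⟦ does (a ≟ c) ⟧ ℕ.* g a) ≡ g c
  ∑ᶠ-δ′ c g = trans (∑ᶠ-cong (λ a → cong (λ b → ⟦ b ⟧ ℕ.* g a) (does-⇔ (mk⇔ sym sym) (a ≟ c) (c ≟ a))))
                    (∑ᶠ-δ c g)

  ∑ᶠ-reindex : (σ σ⁻¹ : Carrier → Carrier) → (∀ a → σ⁻¹ (σ a) ≡ a) → (∀ b → σ (σ⁻¹ b) ≡ b) →
    (f : Carrier → ℕ) → ∑ᶠ (f ∘ σ) ≡ ∑ᶠ f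
  ∑ᶠ-reindex σ σ⁻¹ σ⁻¹σ σσ⁻¹ f = begin
      ∑ᶠ (λ a → f (σ a))                                   ≡⟨ ∑ᶠ-cong (λ a → sym (∑ᶠ-δ (σ a) f)) ⟩
      ∑ᶠ (λ a → ∑ᶠ (λ b → ⟦ does (σ a ≟ b) ⟧ ℕ.* f b))       ≡⟨ ∑-comm elements elements _ ⟩
      ∑ᶠ (λ b → ∑ᶠ (λ a → ⟦ does (σ a ≟ b) ⟧ ℕ.* f b))       ≡⟨ ∑ᶠ-cong (λ b → ∑ᶠ-cong (λ a → cong (λ t → ⟦ t ⟧ ℕ.* f b)
                                                                (does-⇔ (σa≡b⇔ a b) (σ a ≟ b) (σ⁻¹ b ≟ a)))) ⟩
      ∑ᶠ (λ b → ∑ᶠ (λ a → ⟦ does (σ⁻¹ b ≟ a) ⟧ ℕ.* f b))     ≡⟨ ∑ᶠ-cong (λ b → ∑ᶠ-δ (σ⁻¹ b) (λ _ → f b)) ⟩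
      ∑ᶠ f                                                  ∎
    where
    open ≡-Reasoning
    σa≡b⇔ : ∀ a b → (σ a ≡ b) ⇔ (σ⁻¹ b ≡ a)
    σa≡b⇔ a b = mk⇔ (λ e → trans (cong σ⁻¹ (sym e)) (σ⁻¹σ a)) (λ e → trans (cong σ (sym e)) (σσ⁻¹ b))

  q≢0 : q ≢ 0
  q≢0 refl with fromC 0#
  ... | ()

  instance
    q-nonZero : ℕ.NonZero q
    q-nonZero = ℕ.≢-nonZero q≢0

  decide-∀ : {P : Carrier → Set} → (∀ a → Dec (P a)) → Dec (∀ a → P a)
  decide-∀ {P} P? with Finₚ.all? (λ i → P? (toC i))
  ... | yes h = yes λ a → subst P (toC∘fromC a) (h (fromC a))
  ... | no ¬h = no λ h → ¬h (λ i → h (toC i))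

  ¬∀⇒∃¬ : {P : Carrier → Set} → (∀ a → Dec (P a)) → ¬ (∀ a → P a) → ∃ λ a → ¬ P a
  ¬∀⇒∃¬ {P} P? ¬h with Finₚ.¬∀⟶∃¬ q (P ∘ toC) (P? ∘ toC) (λ h → ¬h (λ a → subst P (toC∘fromC a) (h (fromC a))))
  ... | i , ¬p = toC i , ¬p

  open import Algebra.Properties.Group (CommutativeRing.+-group ring)
    using (ε⁻¹≈ε; ⁻¹-injective)
    renaming (⁻¹-involutive to -‿involutive)
  open import Algebra.Properties.Group (CommutativeRing.+-group ring) public
    using () renaming (∙-cancelʳ to +-cancelʳ)

  +-move : ∀ x d c → (x + d ≡ c) ⇔ (d ≡ c + - x)
  +-move x d c = mk⇔ to from
    where
    x+y-y≡x : ∀ x y → x + y + - y ≡ x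
    x+y-y≡x x y = trans (+-assoc x y (- y)) (trans (cong (x +_) (-‿inverseʳ y)) (+-identityʳ x))
    to : x + d ≡ c → d ≡ c + - x
    to e = trans (sym (x+y-y≡x d x)) (cong (_+ - x) (trans (+-comm d x) e))
    from : d ≡ c + - x → x + d ≡ c
    from e = trans (cong (x +_) (trans e (+-comm c (- x))))
                   (trans (sym (+-assoc x (- x) c)) (trans (cong (_+ c) (-‿inverseʳ x)) (+-identityˡ c)))

  0≡c-x⇔x≡c : ∀ c x → (0# ≡ c + - x) ⇔ (x ≡ c)
  0≡c-x⇔x≡c c x = mk⇔ (λ e → trans (sym (+-identityʳ x)) (Equivalence.from (+-move x 0# c) e))
                      (λ e → sym (trans (cong (λ y → c + - y) e) (-‿inverseʳ c)))

  -≡0⇒≡0 : ∀ a → - a ≡ 0# → a ≡ 0#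
  -≡0⇒≡0 a e = ⁻¹-injective (trans e (sym ε⁻¹≈ε))

  _⁻¹[_] : ∀ a → a ≢ 0# → Carrier
  a ⁻¹[ a≢0 ] = proj₁ (inverse a a≢0)

  *-cancelˡ : ∀ a x y → a ≢ 0# → a * x ≡ a * y → x ≡ y
  *-cancelˡ a x y a≢0 e = begin
      x                ≡⟨ cancel x ⟨
      b * (a * x)      ≡⟨ cong (b *_) e ⟩
      b * (a * y)      ≡⟨ cancel y ⟩
      y                ∎
    where
    open ≡-Reasoning
    b = a ⁻¹[ a≢0 ]
    cancel : ∀ z → b * (a * z) ≡ z
    cancel z = trans (sym (*-assoc b a z))
                (trans (cong (_* z) (trans (*-comm b a) (proj₂ (inverse a a≢0)))) (*-identityˡ z))

  *≡0⇒≡0 : ∀ a b → a ≢ 0# → a * b ≡ 0# → b ≡ 0#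
  *≡0⇒≡0 a b a≢0 e = *-cancelˡ a b 0# a≢0 (trans e (sym (zeroʳ a)))

  linear-solution : ∀ u a c (u≢0 : u ≢ 0#) → (u * a ≡ c) ⇔ (u ⁻¹[ u≢0 ] * c ≡ a)
  linear-solution u a c u≢0 = mk⇔
    (λ e → *-cancelˡ u _ a u≢0 (trans (sym (*-assoc u _ c)) (trans (cong (_* c) uu⁻¹) (trans (*-identityˡ c) (sym e)))))
    (λ e → trans (cong (u *_) (sym e)) (trans (sym (*-assoc u _ c)) (trans (cong (_* c) uu⁻¹) (*-identityˡ c))))
    where
    uu⁻¹ : u * u ⁻¹[ u≢0 ] ≡ 1#
    uu⁻¹ = proj₂ (inverse u u≢0)

  ∑ᶠ-linear-δ : ∀ u c (u≢0 : u ≢ 0#) (g : Carrier → ℕ) →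
    ∑ᶠ (λ a → ⟦ does (u * a ≟ c) ⟧ ℕ.* g a) ≡ g (u ⁻¹[ u≢0 ] * c)
  ∑ᶠ-linear-δ u c u≢0 g =
    trans (∑ᶠ-cong λ a → cong (λ b → ⟦ b ⟧ ℕ.* g a) (does-⇔ (linear-solution u a c u≢0) (u * a ≟ c) (_ ≟ a)))
          (∑ᶠ-δ _ g)

  x+x≡[1+1]*x : ∀ x → x + x ≡ (1# + 1#) * x
  x+x≡[1+1]*x x = sym (trans (distribʳ x 1# 1#) (cong₂ _+_ (*-identityˡ x) (*-identityˡ x)))

  char-2 : 2 ∣ q → 1# + 1# ≡ 0#
  char-2 2∣q with 1# + 1# ≟ 0#
  ... | yes 2≡0 = 2≡0
  ... | no 2≢0 = ⊥-elim (¬2∣1+[k+k] (∑ᶠ P) (subst (2 ∣_) q≡1+[P+P] 2∣q))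
    where
    idx : Carrier → ℕ
    idx a = toℕ (fromC a)

    P : Carrier → ℕ
    P a = ⟦ does (idx a ℕ.<? idx (- a)) ⟧

    -- Negation pairs off the nonzero elements: a ≡ - a would give (1 + 1) a ≡ 0.
    a≢-a : ∀ a → a ≢ 0# → idx a ≢ idx (- a)
    a≢-a a a≢0 e = a≢0 (*≡0⇒≡0 (1# + 1#) a 2≢0 (trans (sym (x+x≡[1+1]*x a)) (trans (cong (a +_) a≡-a) (-‿inverseʳ a))))
      where
      a≡-a : a ≡ - a
      a≡-a = trans (sym (toC∘fromC a)) (trans (cong toC (Finₚ.toℕ-injective e)) (toC∘fromC (- a)))

    pair : ∀ a → 1 ≡ ⟦ does (a ≟ 0#) ⟧ ℕ.+ (P a ℕ.+ P (- a))
    pair a with a ≟ 0#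
    ... | yes refl = cong suc (sym (cong₂ ℕ._+_ P0≡0 (trans (cong P ε⁻¹≈ε) P0≡0)))
      where
      P0≡0 : P 0# ≡ 0
      P0≡0 = subst (λ t → ⟦ does (idx 0# ℕ.<? idx t) ⟧ ≡ 0) (sym ε⁻¹≈ε) (⟦<?⟧-irrefl (idx 0#))
    ... | no a≢0 rewrite -‿involutive a = sym (⟦<?⟧+⟦>?⟧≡1 (idx a) (idx (- a)) (a≢-a a a≢0))

    q≡1+[P+P] : q ≡ 1 ℕ.+ (∑ᶠ P ℕ.+ ∑ᶠ P)
    q≡1+[P+P] = begin
        q                                                      ≡⟨ ℕₚ.*-identityʳ q ⟨
        q ℕ.* 1                                                ≡⟨ ∑ᶠ-const 1 ⟨
        ∑ᶠ (λ _ → 1)                                           ≡⟨ ∑ᶠ-cong pair ⟩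
        ∑ᶠ (λ a → ⟦ does (a ≟ 0#) ⟧ ℕ.+ (P a ℕ.+ P (- a)))     ≡⟨ ∑-+ elements _ _ ⟩
        ∑ᶠ (λ a → ⟦ does (a ≟ 0#) ⟧) ℕ.+ ∑ᶠ (λ a → P a ℕ.+ P (- a))
          ≡⟨ cong₂ ℕ._+_ (trans (∑ᶠ-cong (λ a → sym (ℕₚ.*-identityʳ _))) (∑ᶠ-δ′ 0# (λ _ → 1))) (∑-+ elements P _) ⟩
        1 ℕ.+ (∑ᶠ P ℕ.+ ∑ᶠ (P ∘ -_))
          ≡⟨ cong (λ t → 1 ℕ.+ (∑ᶠ P ℕ.+ t)) (∑ᶠ-reindex -_ -_ -‿involutive -‿involutive P) ⟩
        1 ℕ.+ (∑ᶠ P ℕ.+ ∑ᶠ P)                                  ∎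
      where open ≡-Reasoning

  module _ (1+1≡0 : 1# + 1# ≡ 0#) where

    x+x≡0 : ∀ x → x + x ≡ 0#
    x+x≡0 x = trans (x+x≡[1+1]*x x) (trans (cong (_* x) 1+1≡0) (zeroˡ x))

    x+c+c≡x : ∀ c x → x + c + c ≡ x
    x+c+c≡x c x = trans (+-assoc x c c) (trans (cong (x +_) (x+x≡0 c)) (+-identityʳ x))

    x+c+y≡x+y+c : ∀ {c} x y → x + c + y ≡ x + y + c
    x+c+y≡x+y+c {c} x y = trans (+-assoc x c y) (trans (cong (x +_) (+-comm c y)) (sym (+-assoc x y c)))

    AddClosed : (Carrier → Bool) → Set
    AddClosed S = ∀ x y → T (S x) → T (S y) → T (S (x + y))

    size : (Carrier → Bool) → ℕ
    size S = ∑ᶠ (λ a → ⟦ S a ⟧)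

    size≤q : ∀ S → size S ≤ q
    size≤q S = subst (size S ≤_) (trans (∑ᶠ-const 1) (ℕₚ.*-identityʳ q)) (∑-mono-≤ elements (λ a → ⟦⟧-≤1 (S a)))

    ∪coset : (Carrier → Bool) → Carrier → Carrier → Bool
    ∪coset S c x = S x ∨ S (x + c)

    ∪coset-closed : ∀ S c → AddClosed S → AddClosed (∪coset S c)
    ∪coset-closed S c closed x y x∈ y∈ with Equivalence.to T-∨ x∈ | Equivalence.to T-∨ y∈
    ... | inj₁ x∈S | inj₁ y∈S = Equivalence.from T-∨ (inj₁ (closed x y x∈S y∈S))
    ... | inj₁ x∈S | inj₂ y+c∈S = Equivalence.from T-∨ (inj₂ (subst (T ∘ S) (sym (+-assoc x y c)) (closed x (y + c) x∈S y+c∈S)))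
    ... | inj₂ x+c∈S | inj₁ y∈S = Equivalence.from T-∨ (inj₂ (subst (T ∘ S) (x+c+y≡x+y+c x y) (closed (x + c) y x+c∈S y∈S)))
    ... | inj₂ x+c∈S | inj₂ y+c∈S = Equivalence.from T-∨ (inj₁ (subst (T ∘ S) x+c+[y+c]≡x+y (closed (x + c) (y + c) x+c∈S y+c∈S)))
      where
      x+c+[y+c]≡x+y : x + c + (y + c) ≡ x + y
      x+c+[y+c]≡x+y = trans (sym (+-assoc (x + c) y c)) (trans (cong (_+ c) (x+c+y≡x+y+c x y)) (x+c+c≡x c (x + y)))

    size-∪coset : ∀ S c → AddClosed S → ¬ T (S c) → size (∪coset S c) ≡ size S ℕ.+ size S
    size-∪coset S c closed c∉S = begin
        ∑ᶠ (λ x → ⟦ S x ∨ S (x + c) ⟧)          ≡⟨ ∑ᶠ-cong disjoint ⟩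
        ∑ᶠ (λ x → ⟦ S x ⟧ ℕ.+ ⟦ S (x + c) ⟧)    ≡⟨ ∑-+ elements _ _ ⟩
        size S ℕ.+ ∑ᶠ (λ x → ⟦ S (x + c) ⟧)      ≡⟨ cong (size S ℕ.+_) (∑ᶠ-reindex (_+ c) (_+ c) (x+c+c≡x c) (x+c+c≡x c) (λ x → ⟦ S x ⟧)) ⟩
        size S ℕ.+ size S                        ∎
      where
      open ≡-Reasoning
      disjoint : ∀ x → ⟦ S x ∨ S (x + c) ⟧ ≡ ⟦ S x ⟧ ℕ.+ ⟦ S (x + c) ⟧
      disjoint x with S x in x∈S | S (x + c) in x+c∈S
      ... | true | true = ⊥-elim (c∉S (subst (T ∘ S) x+[x+c]≡c
                            (closed x (x + c) (Equivalence.from T-≡ x∈S) (Equivalence.from T-≡ x+c∈S))))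
        where
        x+[x+c]≡c : x + (x + c) ≡ c
        x+[x+c]≡c = trans (sym (+-assoc x x c)) (trans (cong (_+ c) (x+x≡0 x)) (+-identityˡ c))
      ... | true | false = refl
      ... | false | true = refl
      ... | false | false = refl

    -- Adjoin cosets to {0} until the whole field is reached; the fuel satisfies 2 ^ j ≤ q ≤ j + fuel.
    grow : ∀ fuel j S → AddClosed S → size S ≡ 2 ^ j → q ≤ j ℕ.+ fuel → ∃ λ e → q ≡ 2 ^ e
    grow fuel j S closed size≡2^j q≤j+fuel with decide-∀ (λ a → T? (S a))
    ... | yes all = j , trans (sym (ℕₚ.*-identityʳ q))
                          (trans (sym (∑ᶠ-const 1)) (trans (∑ᶠ-cong (λ a → cong ⟦_⟧ (sym (Equivalence.to T-≡ (all a))))) size≡2^j))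
    ... | no ¬all with ¬∀⇒∃¬ (λ a → T? (S a)) ¬all | fuel
    ... | c , c∉S | zero = ⊥-elim (ℕₚ.<-irrefl refl (ℕₚ.<-≤-trans (n<2^n j)
              (ℕₚ.≤-trans (ℕₚ.≤-reflexive (sym size≡2^j))
                (ℕₚ.≤-trans (size≤q S) (ℕₚ.≤-trans q≤j+fuel (ℕₚ.≤-reflexive (ℕₚ.+-identityʳ j)))))))
    ... | c , c∉S | suc fuel′ = grow fuel′ (suc j) (∪coset S c) (∪coset-closed S c closed)
              (trans (size-∪coset S c closed c∉S)
                (trans (cong₂ ℕ._+_ size≡2^j size≡2^j) (cong (2 ^ j ℕ.+_) (sym (ℕₚ.+-identityʳ (2 ^ j))))))
              (subst (q ≤_) (ℕₚ.+-suc j fuel′) q≤j+fuel)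

    zero-closed : AddClosed (λ x → does (x ≟ 0#))
    zero-closed x y x∈ y∈ with x ≟ 0# | y ≟ 0#
    ... | yes refl | yes refl = Equivalence.from T-≡ (dec-true (0# + 0# ≟ 0#) (+-identityʳ 0#))

  q≡2^e : 2 ∣ q → ∃ λ e → q ≡ 2 ^ e
  q≡2^e 2∣q = grow 1+1≡0 q 0 (λ x → does (x ≟ 0#)) (zero-closed 1+1≡0)
    (trans (∑ᶠ-cong (λ a → sym (ℕₚ.*-identityʳ _))) (∑ᶠ-δ′ 0# (λ _ → 1))) ℕₚ.≤-refl
    where
    1+1≡0 = char-2 2∣q

-- m only selects the instance of PG whose enumeration of vectors and dot product are used;
-- the lemmas are about vectors of every length k.
module Counting {q : ℕ} (F : FiniteField q) (m : ℕ) where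

  open Field F
  open PG F m using (Coords; allVecs; normalised; dot)
  open import Data.Nat using (_^_)
  open import Relation.Nullary.Decidable using (dec-true; dec-false)
  open import Algebra.Solver.Ring.NaturalCoefficients (CommutativeRing.commutativeSemiring ring) (λ _ _ → nothing)
    using (solve; _:=_; _:+_; _:*_)

  ∑ᵛ : (k : ℕ) → (Coords k → ℕ) → ℕ
  ∑ᵛ k = ∑ (allVecs k)

  ∑ᵛ-cong : ∀ k {f g : Coords k → ℕ} → (∀ x → f x ≡ g x) → ∑ᵛ k f ≡ ∑ᵛ k g
  ∑ᵛ-cong k = ∑-cong (allVecs k)

  ∑ᵛ-suc : ∀ k (f : Coords (suc k) → ℕ) → ∑ᵛ (suc k) f ≡ ∑ᶠ (λ a → ∑ᵛ k (λ v → f (a ∷ᵛ v)))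
  ∑ᵛ-suc k f = trans (∑-concatMap (λ a → map (a ∷ᵛ_) (allVecs k)) elements f)
                     (∑ᶠ-cong (λ a → ∑-map (a ∷ᵛ_) (allVecs k) f))

  ∑ᵛ-const : ∀ k c → ∑ᵛ k (λ _ → c) ≡ q ^ k ℕ.* c
  ∑ᵛ-const zero c = refl
  ∑ᵛ-const (suc k) c = begin
      ∑ᵛ (suc k) (λ _ → c)               ≡⟨ ∑ᵛ-suc k _ ⟩
      ∑ᶠ (λ _ → ∑ᵛ k (λ _ → c))          ≡⟨ ∑ᶠ-cong (λ _ → ∑ᵛ-const k c) ⟩
      ∑ᶠ (λ _ → q ^ k ℕ.* c)             ≡⟨ ∑ᶠ-const _ ⟩
      q ℕ.* (q ^ k ℕ.* c)                ≡⟨ ℕₚ.*-assoc q (q ^ k) c ⟨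
      q ^ suc k ℕ.* c                    ∎
    where open ≡-Reasoning

  IsZero : ∀ {k} → Coords k → Set
  IsZero u = ∀ i → u i ≡ 0#

  isZero? : ∀ {k} (u : Coords k) → Dec (IsZero u)
  isZero? u = Finₚ.all? (λ i → u i ≟ 0#)

  IsZero-∷ : ∀ {k} (u : Coords (suc k)) → u zero ≡ 0# → IsZero (tail u) → IsZero u
  IsZero-∷ u u₀≡0 _ zero = u₀≡0
  IsZero-∷ u _ tail≡0 (suc i) = tail≡0 i

  dot-zeroˡ : ∀ {k} (u x : Coords k) → IsZero u → dot u x ≡ 0#
  dot-zeroˡ {zero} u x _ = refl
  dot-zeroˡ {suc k} u x u≡0 =
    trans (cong₂ _+_ (trans (cong (_* x zero) (u≡0 zero)) (zeroˡ (x zero))) (dot-zeroˡ (tail u) (tail x) (u≡0 ∘ suc)))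
          (+-identityʳ 0#)

  dot-congˡ : ∀ {k} (u v x : Coords k) → (∀ i → u i ≡ v i) → dot u x ≡ dot v x
  dot-congˡ {zero} u v x e = refl
  dot-congˡ {suc k} u v x e = cong₂ _+_ (cong (_* x zero) (e zero)) (dot-congˡ (tail u) (tail v) (tail x) (e ∘ suc))

  dot-linearˡ : ∀ {k} α β (u v x : Coords k) → dot (λ i → α * u i + β * v i) x ≡ α * dot u x + β * dot v x
  dot-linearˡ {zero} α β u v x = sym (trans (cong₂ _+_ (zeroʳ α) (zeroʳ β)) (+-identityʳ 0#))
  dot-linearˡ {suc k} α β u v x =
    trans (cong ((α * u zero + β * v zero) * x zero +_) (dot-linearˡ α β (tail u) (tail v) (tail x)))
      (solve 7 (λ α β u₀ v₀ x₀ d e → (α :* u₀ :+ β :* v₀) :* x₀ :+ (α :* d :+ β :* e)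
                                   := α :* (u₀ :* x₀ :+ d) :+ β :* (v₀ :* x₀ :+ e))
             refl α β (u zero) (v zero) (x zero) (dot (tail u) (tail x)) (dot (tail v) (tail x)))

  dot-∷≡⇔ : ∀ {k} (u : Coords (suc k)) a x c → (dot u (a ∷ᵛ x) ≡ c) ⇔ (dot (tail u) x ≡ c + - (u zero * a))
  dot-∷≡⇔ u a x c = +-move (u zero * a) (dot (tail u) x) c

  #affine : ∀ k → Coords k → Carrier → ℕ
  #affine k u c = ∑ᵛ k (λ x → ⟦ does (dot u x ≟ c) ⟧)

  #affine-suc : ∀ k (u : Coords (suc k)) c →
    #affine (suc k) u c ≡ ∑ᶠ (λ a → #affine k (tail u) (c + - (u zero * a)))
  #affine-suc k u c = trans (∑ᵛ-suc k _) (∑ᶠ-cong λ a → ∑ᵛ-cong k λ x → cong ⟦_⟧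
    (does-⇔ (dot-∷≡⇔ u a x c) (dot u (a ∷ᵛ x) ≟ c) (dot (tail u) x ≟ _)))

  -- q * #affine rather than #affine = q ^ (k - 1), to avoid truncated subtraction.
  q*#affine : ∀ k (u : Coords k) c → ¬ IsZero u → q ℕ.* #affine k u c ≡ q ^ k
  q*#affine zero u c u≢0 = ⊥-elim (u≢0 λ ())
  q*#affine (suc k) u c u≢0 with isZero? (tail u)
  ... | yes tail≡0 = cong (q ℕ.*_) (begin
      #affine (suc k) u c                                                ≡⟨ #affine-suc k u c ⟩
      ∑ᶠ (λ a → #affine k (tail u) (c + - (u zero * a)))                 ≡⟨ ∑ᶠ-cong count-tail ⟩
      ∑ᶠ (λ a → ⟦ does (u zero * a ≟ c) ⟧ ℕ.* q ^ k)                     ≡⟨ ∑ᶠ-linear-δ (u zero) c u₀≢0 (λ _ → q ^ k) ⟩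
      q ^ k                                                               ∎)
    where
    open ≡-Reasoning
    u₀≢0 : u zero ≢ 0#
    u₀≢0 u₀≡0 = u≢0 (IsZero-∷ u u₀≡0 tail≡0)
    count-tail : ∀ a → #affine k (tail u) (c + - (u zero * a)) ≡ ⟦ does (u zero * a ≟ c) ⟧ ℕ.* q ^ k
    count-tail a = begin
        ∑ᵛ k (λ x → ⟦ does (dot (tail u) x ≟ c + - (u zero * a)) ⟧)
          ≡⟨ ∑ᵛ-cong k (λ x → cong (λ y → ⟦ does (y ≟ _) ⟧) (dot-zeroˡ (tail u) x tail≡0)) ⟩
        ∑ᵛ k (λ _ → ⟦ does (0# ≟ c + - (u zero * a)) ⟧)               ≡⟨ ∑ᵛ-const k _ ⟩
        q ^ k ℕ.* ⟦ does (0# ≟ c + - (u zero * a)) ⟧                   ≡⟨ ℕₚ.*-comm (q ^ k) _ ⟩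
        ⟦ does (0# ≟ c + - (u zero * a)) ⟧ ℕ.* q ^ k                   ≡⟨ cong (λ b → ⟦ b ⟧ ℕ.* q ^ k)
                                                                          (does-⇔ (0≡c-x⇔x≡c c _) (0# ≟ _) (u zero * a ≟ c)) ⟩
        ⟦ does (u zero * a ≟ c) ⟧ ℕ.* q ^ k                             ∎
  ... | no tail≢0 = begin
      q ℕ.* #affine (suc k) u c                                        ≡⟨ cong (q ℕ.*_) (#affine-suc k u c) ⟩
      q ℕ.* ∑ᶠ (λ a → #affine k (tail u) (c + - (u zero * a)))         ≡⟨ ∑-*ˡ elements q _ ⟨
      ∑ᶠ (λ a → q ℕ.* #affine k (tail u) (c + - (u zero * a)))         ≡⟨ ∑ᶠ-cong (λ a → q*#affine k (tail u) _ tail≢0) ⟩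
      ∑ᶠ (λ _ → q ^ k)                                                 ≡⟨ ∑ᶠ-const _ ⟩
      q ^ suc k                                                         ∎
    where open ≡-Reasoning

  Rel : ∀ {k} → Carrier → Carrier → Coords k → Coords k → Set
  Rel α β u v = ∀ i → α * u i + β * v i ≡ 0#

  Independent : ∀ {k} → Coords k → Coords k → Set
  Independent u v = ∀ α β → Rel α β u v → (α ≡ 0#) × (β ≡ 0#)

  Dependent : ∀ {k} → Coords k → Coords k → Set
  Dependent u v = ∃ λ α → ∃ λ β → Rel α β u v × (α ≢ 0# ⊎ β ≢ 0#)

  private
    trivial? : ∀ {k} (u v : Coords k) α β → Dec (Rel α β u v → (α ≡ 0#) × (β ≡ 0#))
    trivial? u v α β = Finₚ.all? (λ i → α * u i + β * v i ≟ 0#) →-dec ((α ≟ 0#) ×-dec (β ≟ 0#))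

  independent-or-dependent : ∀ {k} (u v : Coords k) → Independent u v ⊎ Dependent u v
  independent-or-dependent u v with decide-∀ (λ α → decide-∀ (λ β → trivial? u v α β))
  ... | yes indep = inj₁ indep
  ... | no ¬indep with ¬∀⇒∃¬ (λ α → decide-∀ (λ β → trivial? u v α β)) ¬indep
  ... | α , ¬α with ¬∀⇒∃¬ (trivial? u v α) ¬α
  ... | β , ¬β with Finₚ.all? (λ i → α * u i + β * v i ≟ 0#) | α ≟ 0# | β ≟ 0#
  ...   | no ¬rel  | _       | _       = ⊥-elim (¬β (λ rel → ⊥-elim (¬rel rel)))
  ...   | yes rel  | no α≢0  | _       = inj₂ (α , β , rel , inj₁ α≢0)
  ...   | yes rel  | yes _   | no β≢0  = inj₂ (α , β , rel , inj₂ β≢0)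
  ...   | yes _    | yes α≡0 | yes β≡0 = ⊥-elim (¬β (λ _ → α≡0 , β≡0))

  Rel-swap : ∀ {k α β} {u v : Coords k} → Rel α β u v → Rel β α v u
  Rel-swap rel i = trans (+-comm _ _) (rel i)

  Independent-swap : ∀ {k} {u v : Coords k} → Independent u v → Independent v u
  Independent-swap indep α β rel = let (β≡0 , α≡0) = indep β α (Rel-swap rel) in α≡0 , β≡0

  Rel-∷ : ∀ {k α β} (u v : Coords (suc k)) → α * u zero + β * v zero ≡ 0# → Rel α β (tail u) (tail v) → Rel α β u v
  Rel-∷ u v rel₀ rel zero = rel₀
  Rel-∷ u v rel₀ rel (suc i) = rel i

  module _ {k} (u v : Coords (suc k)) (indep : Independent u v) {α β} (rel : Rel α β (tail u) (tail v)) where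

    leading-combination≢0 : α ≢ 0# ⊎ β ≢ 0# → α * u zero + β * v zero ≢ 0#
    leading-combination≢0 (inj₁ α≢0) e = α≢0 (proj₁ (indep _ _ (Rel-∷ u v e rel)))
    leading-combination≢0 (inj₂ β≢0) e = β≢0 (proj₂ (indep _ _ (Rel-∷ u v e rel)))

    -- If tail v vanished, so would tail u, and then v₀ u - u₀ v ≡ 0 would force u ≡ 0.
    tail-nonzero : α ≢ 0# → ¬ IsZero (tail v)
    tail-nonzero α≢0 tail-v≡0 = 1≢0 (proj₁ (indep 1# 0# u-vanishes))
      where
      tail-u≡0 : IsZero (tail u)
      tail-u≡0 i = *≡0⇒≡0 α (u (suc i)) α≢0
        (trans (sym (+-identityʳ _)) (trans (cong (α * u (suc i) +_) (sym (trans (cong (β *_) (tail-v≡0 i)) (zeroʳ β)))) (rel i)))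
      v₀u-u₀v : Rel (v zero) (- u zero) u v
      v₀u-u₀v zero = trans (cong (v zero * u zero +_) (sym (-‿distribˡ-* (u zero) (v zero))))
                       (trans (cong (_+ - (u zero * v zero)) (*-comm (v zero) (u zero))) (-‿inverseʳ _))
      v₀u-u₀v (suc i) = trans (cong₂ _+_ (trans (cong (v zero *_) (tail-u≡0 i)) (zeroʳ _))
                                          (trans (cong (- u zero *_) (tail-v≡0 i)) (zeroʳ _))) (+-identityʳ 0#)
      u₀≡0 : u zero ≡ 0#
      u₀≡0 = -≡0⇒≡0 (u zero) (proj₂ (indep _ _ v₀u-u₀v))
      u-vanishes : Rel 1# 0# u v
      u-vanishes zero = trans (cong₂ _+_ (trans (*-identityˡ _) u₀≡0) (zeroˡ _)) (+-identityʳ 0#)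
      u-vanishes (suc i) = trans (cong₂ _+_ (trans (*-identityˡ _) (tail-u≡0 i)) (zeroˡ _)) (+-identityʳ 0#)

  dot-combination : ∀ {k} α β (u v x : Coords (suc k)) → Rel α β (tail u) (tail v) →
    α * dot u x + β * dot v x ≡ (α * u zero + β * v zero) * x zero
  dot-combination α β u v x rel = begin
      α * dot u x + β * dot v x                            ≡⟨ dot-linearˡ α β u v x ⟨
      dot (λ i → α * u i + β * v i) x                      ≡⟨ cong (_ +_) (dot-zeroˡ _ (tail x) rel) ⟩
      (α * u zero + β * v zero) * x zero + 0#              ≡⟨ +-identityʳ _ ⟩
      (α * u zero + β * v zero) * x zero                   ∎
    where open ≡-Reasoning

  #affine₂ : ∀ k → Coords k → Coords k → Carrier → Carrier → ℕ
  #affine₂ k u v c d = ∑ᵛ k (λ x → ⟦ does (dot u x ≟ c) ⟧ ℕ.* ⟦ does (dot v x ≟ d) ⟧)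

  #affine₂-swap : ∀ k u v c d → #affine₂ k u v c d ≡ #affine₂ k v u d c
  #affine₂-swap k u v c d = ∑ᵛ-cong k (λ x → ℕₚ.*-comm ⟦ does (dot u x ≟ c) ⟧ _)

  #affine₂-suc : ∀ k (u v : Coords (suc k)) c d →
    #affine₂ (suc k) u v c d ≡ ∑ᶠ (λ a → #affine₂ k (tail u) (tail v) (c + - (u zero * a)) (d + - (v zero * a)))
  #affine₂-suc k u v c d = trans (∑ᵛ-suc k _) (∑ᶠ-cong λ a → ∑ᵛ-cong k λ x → cong₂ (λ b b′ → ⟦ b ⟧ ℕ.* ⟦ b′ ⟧)
    (does-⇔ (dot-∷≡⇔ u a x c) (dot u (a ∷ᵛ x) ≟ c) (dot (tail u) x ≟ _))
    (does-⇔ (dot-∷≡⇔ v a x d) (dot v (a ∷ᵛ x) ≟ d) (dot (tail v) x ≟ _)))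

  -- When the tails are dependent, α(u·x) + β(v·x) only sees x₀, so the system is solved by
  -- fixing x₀ and then solving one nontrivial equation in the remaining coordinates.
  q*q*#affine₂-dependent-tails : ∀ k (u v : Coords (suc k)) c d α β → α ≢ 0# → Rel α β (tail u) (tail v) →
    α * u zero + β * v zero ≢ 0# → ¬ IsZero (tail v) → q ℕ.* (q ℕ.* #affine₂ (suc k) u v c d) ≡ q ^ suc k
  q*q*#affine₂-dependent-tails k u v c d α β α≢0 rel γ≢0 tail-v≢0 = begin
      q ℕ.* (q ℕ.* #affine₂ (suc k) u v c d)                                       ≡⟨ cong (λ t → q ℕ.* (q ℕ.* t)) eliminate-u ⟩
      q ℕ.* (q ℕ.* ∑ᵛ (suc k) (λ x → ⟦ does (γ * x zero ≟ e) ⟧ ℕ.* ⟦ does (dot v x ≟ d) ⟧))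
        ≡⟨ cong (λ t → q ℕ.* (q ℕ.* t)) (trans (∑ᵛ-suc k _) (∑ᶠ-cong split-x₀)) ⟩
      q ℕ.* (q ℕ.* ∑ᶠ (λ a → ⟦ does (γ * a ≟ e) ⟧ ℕ.* #affine k (tail v) (d + - (v zero * a))))
        ≡⟨ cong (q ℕ.*_) (trans (sym (∑-*ˡ elements q _)) (∑ᶠ-cong count-tail)) ⟩
      q ℕ.* ∑ᶠ (λ a → ⟦ does (γ * a ≟ e) ⟧ ℕ.* q ^ k)                             ≡⟨ cong (q ℕ.*_) (∑ᶠ-linear-δ γ e γ≢0 (λ _ → q ^ k)) ⟩
      q ^ suc k                                                                    ∎
    where
    open ≡-Reasoning
    γ = α * u zero + β * v zero
    e = α * c + β * d
    eliminate-u : #affine₂ (suc k) u v c d ≡ ∑ᵛ (suc k) (λ x → ⟦ does (γ * x zero ≟ e) ⟧ ℕ.* ⟦ does (dot v x ≟ d) ⟧)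
    eliminate-u = ∑ᵛ-cong (suc k) λ x → ⟦does⟧*-cong (dot u x ≟ c) (γ * x zero ≟ e) (dot v x ≟ d)
      (λ u·x≡c v·x≡d → trans (sym (dot-combination α β u v x rel)) (cong₂ (λ s t → α * s + β * t) u·x≡c v·x≡d))
      (λ γx₀≡e v·x≡d → *-cancelˡ α _ _ α≢0 (+-cancelʳ (β * d) _ _
        (trans (cong (λ t → α * dot u x + β * t) (sym v·x≡d)) (trans (dot-combination α β u v x rel) γx₀≡e))))
    split-x₀ : ∀ a → ∑ᵛ k (λ x → ⟦ does (γ * a ≟ e) ⟧ ℕ.* ⟦ does (dot v (a ∷ᵛ x) ≟ d) ⟧)
                     ≡ ⟦ does (γ * a ≟ e) ⟧ ℕ.* #affine k (tail v) (d + - (v zero * a))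
    split-x₀ a = trans (∑ᵛ-cong k λ x → cong (λ b → ⟦ does (γ * a ≟ e) ⟧ ℕ.* ⟦ b ⟧)
                         (does-⇔ (dot-∷≡⇔ v a x d) (dot v (a ∷ᵛ x) ≟ d) (dot (tail v) x ≟ _)))
                       (∑-*ˡ (allVecs k) ⟦ does (γ * a ≟ e) ⟧ (λ x → ⟦ does (dot (tail v) x ≟ d + - (v zero * a)) ⟧))
    count-tail : ∀ a → q ℕ.* (⟦ does (γ * a ≟ e) ⟧ ℕ.* #affine k (tail v) (d + - (v zero * a)))
                         ≡ ⟦ does (γ * a ≟ e) ⟧ ℕ.* q ^ k
    count-tail a = trans (sym (ℕₚ.*-assoc q b N)) (trans (cong (ℕ._* N) (ℕₚ.*-comm q b))
                     (trans (ℕₚ.*-assoc b q N) (cong (b ℕ.*_) (q*#affine k (tail v) _ tail-v≢0))))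
      where
      b = ⟦ does (γ * a ≟ e) ⟧
      N = #affine k (tail v) (d + - (v zero * a))

  q*q*#affine₂ : ∀ k (u v : Coords k) c d → Independent u v → q ℕ.* (q ℕ.* #affine₂ k u v c d) ≡ q ^ k
  q*q*#affine₂ zero u v c d indep = ⊥-elim (1≢0 (proj₁ (indep 1# 0# (λ ()))))
  q*q*#affine₂ (suc k) u v c d indep with independent-or-dependent (tail u) (tail v)
  ... | inj₁ tails-indep = begin
      q ℕ.* (q ℕ.* #affine₂ (suc k) u v c d)                  ≡⟨ cong (λ t → q ℕ.* (q ℕ.* t)) (#affine₂-suc k u v c d) ⟩
      q ℕ.* (q ℕ.* ∑ᶠ (λ a → #affine₂ k (tail u) (tail v) _ _)) ≡⟨ cong (q ℕ.*_) (∑-*ˡ elements q _) ⟨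
      q ℕ.* ∑ᶠ (λ a → q ℕ.* #affine₂ k (tail u) (tail v) _ _)   ≡⟨ ∑-*ˡ elements q _ ⟨
      ∑ᶠ (λ a → q ℕ.* (q ℕ.* #affine₂ k (tail u) (tail v) _ _)) ≡⟨ ∑ᶠ-cong (λ a → q*q*#affine₂ k (tail u) (tail v) _ _ tails-indep) ⟩
      ∑ᶠ (λ _ → q ^ k)                                          ≡⟨ ∑ᶠ-const _ ⟩
      q ^ suc k                                                 ∎
    where open ≡-Reasoning
  ... | inj₂ (α , β , rel , inj₁ α≢0) =
    q*q*#affine₂-dependent-tails k u v c d α β α≢0 rel
      (leading-combination≢0 u v indep rel (inj₁ α≢0)) (tail-nonzero u v indep rel α≢0)
  ... | inj₂ (α , β , rel , inj₂ β≢0) =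
    trans (cong (λ t → q ℕ.* (q ℕ.* t)) (#affine₂-swap (suc k) u v c d))
      (q*q*#affine₂-dependent-tails k v u d c β α β≢0 (Rel-swap rel)
        (leading-combination≢0 v u (Independent-swap indep) (Rel-swap rel) (inj₁ β≢0))
        (tail-nonzero v u (Independent-swap indep) (Rel-swap rel) β≢0))

  ∑ᵖ : ∀ k → (Coords k → ℕ) → ℕ
  ∑ᵖ k f = ∑ᵛ k (λ x → ⟦ normalised x ⟧ ℕ.* f x)

  ∑ᵖ-cong : ∀ k {f g : Coords k → ℕ} → (∀ x → f x ≡ g x) → ∑ᵖ k f ≡ ∑ᵖ k g
  ∑ᵖ-cong k e = ∑ᵛ-cong k (λ x → cong (⟦ normalised x ⟧ ℕ.*_) (e x))

  ∑ᵖ-cong-normalised : ∀ k {f g : Coords k → ℕ} → (∀ x → normalised x ≡ true → f x ≡ g x) → ∑ᵖ k f ≡ ∑ᵖ k g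
  ∑ᵖ-cong-normalised k {f} {g} e = ∑ᵛ-cong k pointwise
    where
    pointwise : ∀ x → ⟦ normalised x ⟧ ℕ.* f x ≡ ⟦ normalised x ⟧ ℕ.* g x
    pointwise x with normalised x in nx
    ... | true = cong (1 ℕ.*_) (e x nx)
    ... | false = refl

  ∑ᵖ-+ : ∀ k (f g : Coords k → ℕ) → ∑ᵖ k (λ x → f x ℕ.+ g x) ≡ ∑ᵖ k f ℕ.+ ∑ᵖ k g
  ∑ᵖ-+ k f g = trans (∑ᵛ-cong k (λ x → ℕₚ.*-distribˡ-+ ⟦ normalised x ⟧ (f x) (g x))) (∑-+ (allVecs k) _ _)

  ∑ᵖ-*ˡ : ∀ k c (f : Coords k → ℕ) → ∑ᵖ k (λ x → c ℕ.* f x) ≡ c ℕ.* ∑ᵖ k f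
  ∑ᵖ-*ˡ k c f = trans (∑ᵛ-cong k (λ x → *-left-comm ⟦ normalised x ⟧ c (f x))) (∑-*ˡ (allVecs k) c _)

  ∑ᵖ-*ʳ : ∀ k c (f : Coords k → ℕ) → ∑ᵖ k (λ x → f x ℕ.* c) ≡ ∑ᵖ k f ℕ.* c
  ∑ᵖ-*ʳ k c f = trans (∑ᵖ-cong k (λ x → ℕₚ.*-comm (f x) c)) (trans (∑ᵖ-*ˡ k c f) (ℕₚ.*-comm c _))

  ∑ᵖ-comm : ∀ k (h : Coords k → Coords k → ℕ) →
    ∑ᵖ k (λ x → ∑ᵖ k (λ u → h u x)) ≡ ∑ᵖ k (λ u → ∑ᵖ k (λ x → h u x))
  ∑ᵖ-comm k h = begin
      ∑ᵛ k (λ x → ⟦ normalised x ⟧ ℕ.* ∑ᵛ k (λ u → ⟦ normalised u ⟧ ℕ.* h u x))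
        ≡⟨ ∑ᵛ-cong k (λ x → ∑-*ˡ (allVecs k) ⟦ normalised x ⟧ _) ⟨
      ∑ᵛ k (λ x → ∑ᵛ k (λ u → ⟦ normalised x ⟧ ℕ.* (⟦ normalised u ⟧ ℕ.* h u x)))
        ≡⟨ ∑-comm (allVecs k) (allVecs k) _ ⟩
      ∑ᵛ k (λ u → ∑ᵛ k (λ x → ⟦ normalised x ⟧ ℕ.* (⟦ normalised u ⟧ ℕ.* h u x)))
        ≡⟨ ∑ᵛ-cong k (λ u → ∑ᵖ-*ˡ k ⟦ normalised u ⟧ (h u)) ⟩
      ∑ᵛ k (λ u → ⟦ normalised u ⟧ ℕ.* ∑ᵛ k (λ x → ⟦ normalised x ⟧ ℕ.* h u x))
        ∎
    where open ≡-Reasoning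

  normalised-∷ : ∀ {k} a (v : Coords k) t →
    ⟦ normalised (a ∷ᵛ v) ⟧ ℕ.* t ≡ ⟦ does (a ≟ 1#) ⟧ ℕ.* t ℕ.+ ⟦ does (a ≟ 0#) ⟧ ℕ.* (⟦ normalised v ⟧ ℕ.* t)
  normalised-∷ a v t with a ≟ 1# | a ≟ 0#
  ... | yes a≡1 | yes a≡0 = ⊥-elim (1≢0 (trans (sym a≡1) a≡0))
  ... | yes _   | no _    = sym (ℕₚ.+-identityʳ _)
  ... | no _    | yes _   = sym (ℕₚ.+-identityʳ _)
  ... | no _    | no _    = refl

  -- A point of PG(k) has first nonzero coordinate 1: either x₀ ≡ 1 and the rest is arbitrary,
  -- or x₀ ≡ 0 and the rest is a point of PG(k - 1).
  ∑ᵖ-suc : ∀ k (f : Coords (suc k) → ℕ) →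
    ∑ᵖ (suc k) f ≡ ∑ᵛ k (λ v → f (1# ∷ᵛ v)) ℕ.+ ∑ᵖ k (λ v → f (0# ∷ᵛ v))
  ∑ᵖ-suc k f = begin
      ∑ᵖ (suc k) f                                                          ≡⟨ ∑ᵛ-suc k _ ⟩
      ∑ᶠ (λ a → ∑ᵛ k (λ v → ⟦ normalised (a ∷ᵛ v) ⟧ ℕ.* f (a ∷ᵛ v)))
        ≡⟨ ∑ᶠ-cong (λ a → trans (∑ᵛ-cong k (λ v → normalised-∷ a v (f (a ∷ᵛ v))))
             (trans (∑-+ (allVecs k) _ _) (cong₂ ℕ._+_ (∑-*ˡ (allVecs k) ⟦ does (a ≟ 1#) ⟧ (λ v → f (a ∷ᵛ v)))
                                                       (∑-*ˡ (allVecs k) ⟦ does (a ≟ 0#) ⟧ (λ v → ⟦ normalised v ⟧ ℕ.* f (a ∷ᵛ v)))))) ⟩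
      ∑ᶠ (λ a → ⟦ does (a ≟ 1#) ⟧ ℕ.* ∑ᵛ k (λ v → f (a ∷ᵛ v)) ℕ.+ ⟦ does (a ≟ 0#) ⟧ ℕ.* ∑ᵖ k (λ v → f (a ∷ᵛ v)))
        ≡⟨ ∑-+ elements _ _ ⟩
      ∑ᶠ (λ a → ⟦ does (a ≟ 1#) ⟧ ℕ.* ∑ᵛ k (λ v → f (a ∷ᵛ v))) ℕ.+ ∑ᶠ (λ a → ⟦ does (a ≟ 0#) ⟧ ℕ.* ∑ᵖ k (λ v → f (a ∷ᵛ v)))
        ≡⟨ cong₂ ℕ._+_ (∑ᶠ-δ′ 1# (λ a → ∑ᵛ k (λ v → f (a ∷ᵛ v)))) (∑ᶠ-δ′ 0# (λ a → ∑ᵖ k (λ v → f (a ∷ᵛ v)))) ⟩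
      ∑ᵛ k (λ v → f (1# ∷ᵛ v)) ℕ.+ ∑ᵖ k (λ v → f (0# ∷ᵛ v))                ∎
    where open ≡-Reasoning

  -- θ k = 1 + q + ⋯ + q ^ (k - 1) is the number of points of PG(k - 1, q).
  θ : ℕ → ℕ
  θ zero = 0
  θ (suc k) = q ^ k ℕ.+ θ k

  ∑ᵖ-1 : ∀ k → ∑ᵖ k (λ _ → 1) ≡ θ k
  ∑ᵖ-1 zero = refl
  ∑ᵖ-1 (suc k) = trans (∑ᵖ-suc k _) (cong₂ ℕ._+_ (trans (∑ᵛ-const k 1) (ℕₚ.*-identityʳ _)) (∑ᵖ-1 k))

  dot-0∷ : ∀ {k} (u : Coords (suc k)) x → dot u (0# ∷ᵛ x) ≡ dot (tail u) x
  dot-0∷ u x = trans (cong (_+ dot (tail u) x) (zeroʳ (u zero))) (+-identityˡ _)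

  #affine-zeroˡ : ∀ k (u : Coords k) c → IsZero u → #affine k u c ≡ q ^ k ℕ.* ⟦ does (0# ≟ c) ⟧
  #affine-zeroˡ k u c u≡0 = trans (∑ᵛ-cong k (λ x → cong (λ y → ⟦ does (y ≟ c) ⟧) (dot-zeroˡ u x u≡0))) (∑ᵛ-const k _)

  #on : ∀ k → Coords k → ℕ
  #on k u = ∑ᵖ k (λ x → ⟦ does (dot u x ≟ 0#) ⟧)

  #on-suc : ∀ k (u : Coords (suc k)) → #on (suc k) u ≡ #affine k (tail u) (0# + - (u zero * 1#)) ℕ.+ #on k (tail u)
  #on-suc k u = trans (∑ᵖ-suc k _) (cong₂ ℕ._+_
    (∑ᵛ-cong k (λ x → cong ⟦_⟧ (does-⇔ (dot-∷≡⇔ u 1# x 0#) (dot u (1# ∷ᵛ x) ≟ 0#) (dot (tail u) x ≟ _))))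
    (∑ᵖ-cong k (λ x → cong (λ y → ⟦ does (y ≟ 0#) ⟧) (dot-0∷ u x))))

  #on-zero : ∀ k (u : Coords k) → IsZero u → #on k u ≡ θ k
  #on-zero k u u≡0 = trans (∑ᵖ-cong k (λ x → cong ⟦_⟧ (dec-true (dot u x ≟ 0#) (dot-zeroˡ u x u≡0)))) (∑ᵖ-1 k)

  #on-nonzero : ∀ k (u : Coords (suc k)) → ¬ IsZero u → #on (suc k) u ≡ θ k
  #on-nonzero k u u≢0 with isZero? (tail u)
  ... | yes tail≡0 = begin
      #on (suc k) u                                                    ≡⟨ #on-suc k u ⟩
      #affine k (tail u) (0# + - (u zero * 1#)) ℕ.+ #on k (tail u)     ≡⟨ cong₂ ℕ._+_ no-point-with-x₀≡1 (#on-zero k (tail u) tail≡0) ⟩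
      0 ℕ.+ θ k                                                        ∎
    where
    open ≡-Reasoning
    no-point-with-x₀≡1 : #affine k (tail u) (0# + - (u zero * 1#)) ≡ 0
    no-point-with-x₀≡1 = trans (#affine-zeroˡ k (tail u) _ tail≡0)
      (trans (cong (λ b → q ^ k ℕ.* ⟦ b ⟧) (dec-false (0# ≟ _) λ e →
                u≢0 (IsZero-∷ u (trans (sym (*-identityʳ _)) (Equivalence.to (0≡c-x⇔x≡c 0# _) e)) tail≡0)))
             (ℕₚ.*-zeroʳ (q ^ k)))
  ... | no tail≢0 with k
  ...   | zero = ⊥-elim (tail≢0 (λ ()))
  ...   | suc k′ = begin
      #on (suc (suc k′)) u                                                       ≡⟨ #on-suc (suc k′) u ⟩
      #affine (suc k′) (tail u) (0# + - (u zero * 1#)) ℕ.+ #on (suc k′) (tail u)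
        ≡⟨ cong₂ ℕ._+_ (ℕₚ.*-cancelˡ-≡ _ _ q (q*#affine (suc k′) (tail u) _ tail≢0)) (#on-nonzero k′ (tail u) tail≢0) ⟩
      θ (suc k′)                                                                 ∎
    where open ≡-Reasoning

  #on₂ : ∀ k → Coords k → Coords k → ℕ
  #on₂ k u v = ∑ᵖ k (λ x → ⟦ does (dot u x ≟ 0#) ⟧ ℕ.* ⟦ does (dot v x ≟ 0#) ⟧)

  #on₂-swap : ∀ k u v → #on₂ k u v ≡ #on₂ k v u
  #on₂-swap k u v = ∑ᵖ-cong k (λ x → ℕₚ.*-comm ⟦ does (dot u x ≟ 0#) ⟧ _)

  #on₂-suc : ∀ k (u v : Coords (suc k)) → #on₂ (suc k) u v ≡
    ∑ᵛ k (λ x → ⟦ does (dot u (1# ∷ᵛ x) ≟ 0#) ⟧ ℕ.* ⟦ does (dot v (1# ∷ᵛ x) ≟ 0#) ⟧) ℕ.+ #on₂ k (tail u) (tail v)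
  #on₂-suc k u v = trans (∑ᵖ-suc k _)
    (cong (∑ᵛ k (λ x → ⟦ does (dot u (1# ∷ᵛ x) ≟ 0#) ⟧ ℕ.* ⟦ does (dot v (1# ∷ᵛ x) ≟ 0#) ⟧) ℕ.+_)
    (∑ᵖ-cong k (λ x → cong₂ (λ s t → ⟦ does (s ≟ 0#) ⟧ ℕ.* ⟦ does (t ≟ 0#) ⟧) (dot-0∷ u x) (dot-0∷ v x))))

  ¬Independent-length1 : (u v : Coords 1) → ¬ Independent u v
  ¬Independent-length1 u v indep = tail-nonzero u v indep {β = 0#} (λ ()) 1≢0 (λ ())

  -- With dependent tails no point has x₀ ≡ 1, and on x₀ ≡ 0 the second equation implies the first.
  #on₂-dependent-tails : ∀ k (u v : Coords (suc (suc k))) α β → Independent u v → Rel α β (tail u) (tail v) → α ≢ 0# →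
    #on₂ (suc (suc k)) u v ≡ θ k
  #on₂-dependent-tails k u v α β indep rel α≢0 = begin
      #on₂ (suc (suc k)) u v                         ≡⟨ #on₂-suc (suc k) u v ⟩
      ∑ᵛ (suc k) (λ x → ⟦ does (dot u (1# ∷ᵛ x) ≟ 0#) ⟧ ℕ.* ⟦ does (dot v (1# ∷ᵛ x) ≟ 0#) ⟧) ℕ.+ #on₂ (suc k) (tail u) (tail v)
        ≡⟨ cong₂ ℕ._+_ (∑-zero (allVecs (suc k)) (λ x → ⟦does⟧*-disjoint (dot u (1# ∷ᵛ x) ≟ 0#) (dot v (1# ∷ᵛ x) ≟ 0#)
                                                          (λ u·x≡0 v·x≡0 → γ≢0 (γ≡0 x u·x≡0 v·x≡0))))
                       (∑ᵖ-cong (suc k) (λ x → ⟦does⟧*-implied (dot (tail u) x ≟ 0#) (dot (tail v) x ≟ 0#) (first-follows x))) ⟩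
      0 ℕ.+ #on (suc k) (tail v)                    ≡⟨ #on-nonzero k (tail v) (tail-nonzero u v indep rel α≢0) ⟩
      θ k                                           ∎
    where
    open ≡-Reasoning
    γ≢0 = leading-combination≢0 u v indep rel (inj₁ α≢0)
    γ≡0 : ∀ x → dot u (1# ∷ᵛ x) ≡ 0# → dot v (1# ∷ᵛ x) ≡ 0# → α * u zero + β * v zero ≡ 0#
    γ≡0 x u·x≡0 v·x≡0 = trans (sym (*-identityʳ _)) (trans (sym (dot-combination α β u v (1# ∷ᵛ x) rel))
      (trans (cong₂ (λ s t → α * s + β * t) u·x≡0 v·x≡0) (trans (cong₂ _+_ (zeroʳ α) (zeroʳ β)) (+-identityʳ 0#))))
    first-follows : ∀ x → dot (tail v) x ≡ 0# → dot (tail u) x ≡ 0#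
    first-follows x v·x≡0 = *≡0⇒≡0 α (dot (tail u) x) α≢0
      (trans (sym (+-identityʳ _)) (trans (cong (α * dot (tail u) x +_) (sym (trans (cong (β *_) v·x≡0) (zeroʳ β))))
        (trans (sym (dot-linearˡ α β (tail u) (tail v) x)) (dot-zeroˡ _ x rel))))

  #on₂-independent : ∀ k (u v : Coords (suc (suc k))) → Independent u v → #on₂ (suc (suc k)) u v ≡ θ k
  #on₂-independent k u v indep with independent-or-dependent (tail u) (tail v)
  ... | inj₂ (α , β , rel , inj₁ α≢0) = #on₂-dependent-tails k u v α β indep rel α≢0
  ... | inj₂ (α , β , rel , inj₂ β≢0) =
    trans (#on₂-swap _ u v) (#on₂-dependent-tails k v u β α (Independent-swap indep) (Rel-swap rel) β≢0)
  ... | inj₁ tails-indep with k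
  ...   | zero = ⊥-elim (¬Independent-length1 (tail u) (tail v) tails-indep)
  ...   | suc k′ = begin
      #on₂ (suc (suc (suc k′))) u v                 ≡⟨ #on₂-suc (suc (suc k′)) u v ⟩
      ∑ᵛ (suc (suc k′)) (λ x → ⟦ does (dot u (1# ∷ᵛ x) ≟ 0#) ⟧ ℕ.* ⟦ does (dot v (1# ∷ᵛ x) ≟ 0#) ⟧) ℕ.+ #on₂ (suc (suc k′)) (tail u) (tail v)
        ≡⟨ cong₂ ℕ._+_ (∑ᵛ-cong (suc (suc k′)) (λ x → cong₂ (λ b b′ → ⟦ b ⟧ ℕ.* ⟦ b′ ⟧)
                          (does-⇔ (dot-∷≡⇔ u 1# x 0#) (dot u (1# ∷ᵛ x) ≟ 0#) (dot (tail u) x ≟ _))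
                          (does-⇔ (dot-∷≡⇔ v 1# x 0#) (dot v (1# ∷ᵛ x) ≟ 0#) (dot (tail v) x ≟ _))))
                       (#on₂-independent k′ (tail u) (tail v) tails-indep) ⟩
      #affine₂ (suc (suc k′)) (tail u) (tail v) _ _ ℕ.+ θ k′
        ≡⟨ cong (ℕ._+ θ k′) (ℕₚ.*-cancelˡ-≡ _ _ q (ℕₚ.*-cancelˡ-≡ _ _ q
             (q*q*#affine₂ (suc (suc k′)) (tail u) (tail v) _ _ tails-indep))) ⟩
      θ (suc k′)                                    ∎
    where open ≡-Reasoning

  sameCoords : ∀ {k} → Coords k → Coords k → Bool
  sameCoords {zero} u v = true
  sameCoords {suc k} u v = does (u zero ≟ v zero) ∧ sameCoords (tail u) (tail v)

  sameCoords⇒≗ : ∀ {k} (u v : Coords k) → sameCoords u v ≡ true → ∀ i → u i ≡ v i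
  sameCoords⇒≗ {suc k} u v same i with u zero ≟ v zero
  sameCoords⇒≗ {suc k} u v same zero    | yes u₀≡v₀ = u₀≡v₀
  sameCoords⇒≗ {suc k} u v same (suc i) | yes _ = sameCoords⇒≗ (tail u) (tail v) same i

  sameCoords-∷ : ∀ {k} (u v : Coords (suc k)) → u zero ≡ v zero → sameCoords u v ≡ sameCoords (tail u) (tail v)
  sameCoords-∷ u v u₀≡v₀ rewrite dec-true (u zero ≟ v zero) u₀≡v₀ = refl

  ≗⇒sameCoords : ∀ {k} (u v : Coords k) → (∀ i → u i ≡ v i) → sameCoords u v ≡ true
  ≗⇒sameCoords {zero} u v e = refl
  ≗⇒sameCoords {suc k} u v e = trans (sameCoords-∷ u v (e zero)) (≗⇒sameCoords (tail u) (tail v) (e ∘ suc))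

  distinct⇒≉ : ∀ {k} {u v : Coords k} → sameCoords u v ≡ false → ¬ (∀ i → u i ≡ v i)
  distinct⇒≉ {u = u} {v} u≠v u≗v with () ← trans (sym (≗⇒sameCoords u v u≗v)) u≠v

  normalised⇒nonzero : ∀ {k} (w : Coords k) → normalised w ≡ true → ¬ IsZero w
  normalised⇒nonzero {suc k} w nw w≡0 with w zero ≟ 1# | w zero ≟ 0#
  ... | yes w₀≡1 | _     = 1≢0 (trans (sym w₀≡1) (w≡0 zero))
  ... | no _     | yes _ = normalised⇒nonzero (tail w) nw (w≡0 ∘ suc)

  leading-1-0-independent : ∀ {k} (u v : Coords (suc k)) → u zero ≡ 1# → v zero ≡ 0# →
    normalised (tail v) ≡ true → Independent u v
  leading-1-0-independent u v u₀≡1 v₀≡0 n-tail-v α β rel = α≡0 , β≡0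
    where
    α≡0 : α ≡ 0#
    α≡0 = trans (sym (*-identityʳ α)) (trans (cong (α *_) (sym u₀≡1)) (trans (sym (+-identityʳ _))
            (trans (cong (α * u zero +_) (sym (trans (cong (β *_) v₀≡0) (zeroʳ β)))) (rel zero))))
    β≡0 : β ≡ 0#
    β≡0 with β ≟ 0#
    ... | yes β≡0 = β≡0
    ... | no β≢0 = ⊥-elim (normalised⇒nonzero (tail v) n-tail-v λ i → *≡0⇒≡0 β (v (suc i)) β≢0
            (trans (sym (+-identityˡ _)) (trans (cong (_+ β * v (suc i)) (sym (trans (cong (_* u (suc i)) α≡0) (zeroˡ _))))
              (rel (suc i)))))

  distinct-points-independent : ∀ k (u v : Coords k) → normalised u ≡ true → normalised v ≡ true →
    sameCoords u v ≡ false → Independent u v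
  distinct-points-independent (suc k) u v nu nv u≠v with u zero ≟ 1# | u zero ≟ 0# | v zero ≟ 1# | v zero ≟ 0#
  ... | yes u₀≡1 | _ | no _ | yes v₀≡0 = leading-1-0-independent u v u₀≡1 v₀≡0 nv
  ... | no _ | yes u₀≡0 | yes v₀≡1 | _ = Independent-swap (leading-1-0-independent v u v₀≡1 u₀≡0 nu)
  ... | yes u₀≡1 | _ | yes v₀≡1 | _ = both-leading-1
    where
    both-leading-1 : Independent u v
    both-leading-1 α β rel with α ≟ 0#
    ... | yes α≡0 = α≡0 , trans (sym (+-identityˡ _)) (trans (cong (_+ β) (sym α≡0)) α+β≡0)
      where
      α+β≡0 : α + β ≡ 0#
      α+β≡0 = trans (cong₂ _+_ (trans (sym (*-identityʳ α)) (cong (α *_) (sym u₀≡1)))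
                                (trans (sym (*-identityʳ β)) (cong (β *_) (sym v₀≡1)))) (rel zero)
    ... | no α≢0 = ⊥-elim (distinct⇒≉ u≠v u≗v)
      where
      α+β≡0 : α + β ≡ 0#
      α+β≡0 = trans (cong₂ _+_ (trans (sym (*-identityʳ α)) (cong (α *_) (sym u₀≡1)))
                                (trans (sym (*-identityʳ β)) (cong (β *_) (sym v₀≡1)))) (rel zero)
      u≗v : ∀ i → u i ≡ v i
      u≗v zero = trans u₀≡1 (sym v₀≡1)
      u≗v (suc i) = *-cancelˡ α _ _ α≢0 (+-cancelʳ (β * v (suc i)) _ _
        (trans (rel (suc i)) (sym (trans (sym (distribʳ (v (suc i)) α β)) (trans (cong (_* v (suc i)) α+β≡0) (zeroˡ _))))))
  ... | no _ | yes u₀≡0 | no _ | yes v₀≡0 = λ α β rel →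
    distinct-points-independent k (tail u) (tail v) nu nv (trans (sym (sameCoords-∷ u v (trans u₀≡0 (sym v₀≡0)))) u≠v) α β (rel ∘ suc)

  ∑ᵛ-diagonal : ∀ k (f : Coords k → Coords k → ℕ) →
    ∑ᵛ k (λ u → ∑ᵛ k (λ v → ⟦ sameCoords u v ⟧ ℕ.* f u v)) ≡ ∑ᵛ k (λ u → f u u)
  ∑ᵛ-diagonal zero f = cong (ℕ._+ 0) (trans (ℕₚ.+-identityʳ _) (ℕₚ.*-identityˡ _))
  ∑ᵛ-diagonal (suc k) f = begin
      ∑ᵛ (suc k) (λ u → ∑ᵛ (suc k) (λ v → ⟦ sameCoords u v ⟧ ℕ.* f u v))
        ≡⟨ ∑ᵛ-suc k _ ⟩
      ∑ᶠ (λ a → ∑ᵛ k (λ u → ∑ᵛ (suc k) (λ v → ⟦ sameCoords (a ∷ᵛ u) v ⟧ ℕ.* f (a ∷ᵛ u) v)))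
        ≡⟨ ∑ᶠ-cong (λ a → ∑ᵛ-cong k (λ u → trans (∑ᵛ-suc k _) (∑ᶠ-cong (λ b → inner a b u)))) ⟩
      ∑ᶠ (λ a → ∑ᵛ k (λ u → ∑ᶠ (λ b → ⟦ does (a ≟ b) ⟧ ℕ.* ∑ᵛ k (λ v → ⟦ sameCoords u v ⟧ ℕ.* f (a ∷ᵛ u) (b ∷ᵛ v)))))
        ≡⟨ ∑ᶠ-cong (λ a → ∑ᵛ-cong k (λ u → ∑ᶠ-δ a _)) ⟩
      ∑ᶠ (λ a → ∑ᵛ k (λ u → ∑ᵛ k (λ v → ⟦ sameCoords u v ⟧ ℕ.* f (a ∷ᵛ u) (a ∷ᵛ v))))
        ≡⟨ ∑ᶠ-cong (λ a → ∑ᵛ-diagonal k (λ u v → f (a ∷ᵛ u) (a ∷ᵛ v))) ⟩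
      ∑ᶠ (λ a → ∑ᵛ k (λ u → f (a ∷ᵛ u) (a ∷ᵛ u)))
        ≡⟨ ∑ᵛ-suc k _ ⟨
      ∑ᵛ (suc k) (λ u → f u u)
        ∎
    where
    open ≡-Reasoning
    inner : ∀ a b u → ∑ᵛ k (λ v → ⟦ sameCoords (a ∷ᵛ u) (b ∷ᵛ v) ⟧ ℕ.* f (a ∷ᵛ u) (b ∷ᵛ v))
                    ≡ ⟦ does (a ≟ b) ⟧ ℕ.* ∑ᵛ k (λ v → ⟦ sameCoords u v ⟧ ℕ.* f (a ∷ᵛ u) (b ∷ᵛ v))
    inner a b u = trans (∑ᵛ-cong k (λ v → trans (cong (ℕ._* g v) (⟦∧⟧ (does (a ≟ b)) (sameCoords u v)))
                                                (ℕₚ.*-assoc ⟦ does (a ≟ b) ⟧ ⟦ sameCoords u v ⟧ (g v))))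
                        (∑-*ˡ (allVecs k) ⟦ does (a ≟ b) ⟧ (λ v → ⟦ sameCoords u v ⟧ ℕ.* g v))
      where
      g : Coords k → ℕ
      g v = f (a ∷ᵛ u) (b ∷ᵛ v)

  ∑ᵖ-diagonal : ∀ k (g : Coords k → Coords k → ℕ) →
    ∑ᵖ k (λ u → ∑ᵖ k (λ v → ⟦ sameCoords u v ⟧ ℕ.* g u v)) ≡ ∑ᵖ k (λ u → g u u)
  ∑ᵖ-diagonal k g = begin
      ∑ᵛ k (λ u → ⟦ normalised u ⟧ ℕ.* ∑ᵛ k (λ v → ⟦ normalised v ⟧ ℕ.* (⟦ sameCoords u v ⟧ ℕ.* g u v)))
        ≡⟨ ∑ᵛ-cong k (λ u → trans (sym (∑-*ˡ (allVecs k) ⟦ normalised u ⟧ (λ v → ⟦ normalised v ⟧ ℕ.* (⟦ sameCoords u v ⟧ ℕ.* g u v))))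
                                  (∑ᵛ-cong k (λ v → reorder u v))) ⟩
      ∑ᵛ k (λ u → ∑ᵛ k (λ v → ⟦ sameCoords u v ⟧ ℕ.* (⟦ normalised u ⟧ ℕ.* (⟦ normalised v ⟧ ℕ.* g u v))))
        ≡⟨ ∑ᵛ-diagonal k (λ u v → ⟦ normalised u ⟧ ℕ.* (⟦ normalised v ⟧ ℕ.* g u v)) ⟩
      ∑ᵛ k (λ u → ⟦ normalised u ⟧ ℕ.* (⟦ normalised u ⟧ ℕ.* g u u))
        ≡⟨ ∑ᵛ-cong k (λ u → trans (sym (ℕₚ.*-assoc ⟦ normalised u ⟧ ⟦ normalised u ⟧ (g u u)))
                                  (cong (ℕ._* g u u) (⟦⟧-idem (normalised u)))) ⟩
      ∑ᵛ k (λ u → ⟦ normalised u ⟧ ℕ.* g u u)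
        ∎
    where
    open ≡-Reasoning
    reorder : ∀ u v → ⟦ normalised u ⟧ ℕ.* (⟦ normalised v ⟧ ℕ.* (⟦ sameCoords u v ⟧ ℕ.* g u v))
                    ≡ ⟦ sameCoords u v ⟧ ℕ.* (⟦ normalised u ⟧ ℕ.* (⟦ normalised v ⟧ ℕ.* g u v))
    reorder u v = trans (cong (⟦ normalised u ⟧ ℕ.*_) (*-left-comm ⟦ normalised v ⟧ ⟦ sameCoords u v ⟧ (g u v)))
                        (*-left-comm ⟦ normalised u ⟧ ⟦ sameCoords u v ⟧ _)

  ∑ᵖ-≡-mod : ∀ k (f g : Coords k → ℕ) c → (∀ x → normalised x ≡ true → ∃ λ w → f x ≡ g x ℕ.+ c ℕ.* w) →
    ∃ λ W → ∑ᵖ k f ≡ ∑ᵖ k g ℕ.+ c ℕ.* W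
  ∑ᵖ-≡-mod k f g c pointwise = ∑-≡-mod (allVecs k) _ _ c weighted
    where
    weighted : ∀ x → ∃ λ w → ⟦ normalised x ⟧ ℕ.* f x ≡ ⟦ normalised x ⟧ ℕ.* g x ℕ.+ c ℕ.* w
    weighted x with normalised x in nx
    ... | false = 0 , sym (ℕₚ.*-zeroʳ c)
    ... | true with pointwise x nx
    ...   | w , fx≡ = w , trans (ℕₚ.+-identityʳ (f x)) (trans fx≡ (cong (ℕ._+ c ℕ.* w) (sym (ℕₚ.+-identityʳ (g x)))))

module Moments {q : ℕ} (F : FiniteField q) (M : ℕ) (H : PG.HyperplaneSet F (suc M)) where

  open Field F using (_≟_; 0#)
  open Counting F (suc M)
  open PG F (suc M) using (Point; allVecs; normalised; dot; card; through)
  open import Data.Nat using (_+_; _*_; _^_)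
  open import Data.Nat.Tactic.RingSolver using (solve-∀)

  K : ℕ
  K = suc (suc M)

  |H| : ℕ
  |H| = ∑ᵖ K (λ u → ⟦ H u ⟧)

  incidence : Point → Point → ℕ
  incidence u x = ⟦ H u ⟧ * ⟦ does (dot u x ≟ 0#) ⟧

  t : Point → ℕ
  t x = ∑ᵖ K (λ u → incidence u x)

  card≡|H| : card H ≡ |H|
  card≡|H| = length-filter∘filter≡∑ (allVecs K) normalised H

  through≡t : ∀ x → through H x ≡ t x
  through≡t x = trans (length-filter∘filter≡∑ (allVecs K) normalised (λ u → H u ∧ PG.incident F (suc M) u x))
    (∑ᵛ-cong K (λ u → cong (⟦ normalised u ⟧ *_) (⟦∧⟧ (H u) _)))

  ∑t : ∑ᵖ K t ≡ |H| * θ (suc M)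
  ∑t = begin
      ∑ᵖ K t                                          ≡⟨ ∑ᵖ-comm K incidence ⟩
      ∑ᵖ K (λ u → ∑ᵖ K (λ x → incidence u x))        ≡⟨ ∑ᵖ-cong K (λ u → ∑ᵖ-*ˡ K ⟦ H u ⟧ _) ⟩
      ∑ᵖ K (λ u → ⟦ H u ⟧ * #on K u)                 ≡⟨ ∑ᵖ-cong-normalised K (λ u nu → cong (⟦ H u ⟧ *_)
                                                          (#on-nonzero (suc M) u (normalised⇒nonzero u nu))) ⟩
      ∑ᵖ K (λ u → ⟦ H u ⟧ * θ (suc M))               ≡⟨ ∑ᵖ-*ʳ K (θ (suc M)) _ ⟩
      |H| * θ (suc M)                                 ∎
    where open ≡-Reasoning

  #on₂-points : ∀ u v → normalised u ≡ true → normalised v ≡ true →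
    #on₂ K u v ≡ θ M + ⟦ sameCoords u v ⟧ * q ^ M
  #on₂-points u v nu nv with sameCoords u v in same
  ... | false = trans (#on₂-independent M u v (distinct-points-independent K u v nu nv same)) (sym (ℕₚ.+-identityʳ _))
  ... | true = begin
      #on₂ K u v      ≡⟨ ∑ᵖ-cong K (λ x → trans (cong (λ y → ⟦ does (dot u x ≟ 0#) ⟧ * ⟦ does (y ≟ 0#) ⟧)
                                                      (dot-congˡ v u x (λ i → sym (sameCoords⇒≗ u v same i))))
                                                (⟦⟧-idem (does (dot u x ≟ 0#)))) ⟩
      #on K u         ≡⟨ #on-nonzero (suc M) u (normalised⇒nonzero u nu) ⟩
      q ^ M + θ M     ≡⟨ ℕₚ.+-comm (q ^ M) (θ M) ⟩
      θ M + q ^ M     ≡⟨ cong (θ M +_) (ℕₚ.*-identityˡ (q ^ M)) ⟨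
      θ M + 1 * q ^ M ∎
    where open ≡-Reasoning

  ∑t² : ∑ᵖ K (λ x → t x * t x) ≡ |H| * |H| * θ M + q ^ M * |H|
  ∑t² = begin
      ∑ᵖ K (λ x → t x * t x)
        ≡⟨ ∑ᵖ-cong K expand-square ⟩
      ∑ᵖ K (λ x → ∑ᵖ K (λ u → ∑ᵖ K (λ v → incidence u x * incidence v x)))
        ≡⟨ ∑ᵖ-comm K (λ u x → ∑ᵖ K (λ v → incidence u x * incidence v x)) ⟩
      ∑ᵖ K (λ u → ∑ᵖ K (λ x → ∑ᵖ K (λ v → incidence u x * incidence v x)))
        ≡⟨ ∑ᵖ-cong K (λ u → ∑ᵖ-comm K (λ v x → incidence u x * incidence v x)) ⟩
      ∑ᵖ K (λ u → ∑ᵖ K (λ v → ∑ᵖ K (λ x → incidence u x * incidence v x)))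
        ≡⟨ ∑ᵖ-cong K (λ u → ∑ᵖ-cong K (λ v → common-points u v)) ⟩
      ∑ᵖ K (λ u → ∑ᵖ K (λ v → (⟦ H u ⟧ * ⟦ H v ⟧) * #on₂ K u v))
        ≡⟨ ∑ᵖ-cong-normalised K (λ u nu → ∑ᵖ-cong-normalised K (λ v nv → split-pair u v nu nv)) ⟩
      ∑ᵖ K (λ u → ∑ᵖ K (λ v → θ M * (⟦ H u ⟧ * ⟦ H v ⟧) + q ^ M * (⟦ sameCoords u v ⟧ * (⟦ H u ⟧ * ⟦ H v ⟧))))
        ≡⟨ ∑ᵖ-cong K (λ u → trans (∑ᵖ-+ K _ _) (cong₂ _+_ (∑ᵖ-*ˡ K (θ M) _) (∑ᵖ-*ˡ K (q ^ M) _))) ⟩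
      ∑ᵖ K (λ u → θ M * ∑ᵖ K (λ v → ⟦ H u ⟧ * ⟦ H v ⟧) + q ^ M * ∑ᵖ K (λ v → ⟦ sameCoords u v ⟧ * (⟦ H u ⟧ * ⟦ H v ⟧)))
        ≡⟨ trans (∑ᵖ-+ K _ _) (cong₂ _+_ (∑ᵖ-*ˡ K (θ M) _) (∑ᵖ-*ˡ K (q ^ M) _)) ⟩
      θ M * ∑ᵖ K (λ u → ∑ᵖ K (λ v → ⟦ H u ⟧ * ⟦ H v ⟧)) + q ^ M * ∑ᵖ K (λ u → ∑ᵖ K (λ v → ⟦ sameCoords u v ⟧ * (⟦ H u ⟧ * ⟦ H v ⟧)))
        ≡⟨ cong₂ (λ s d → θ M * s + q ^ M * d) square diagonal ⟩
      θ M * (|H| * |H|) + q ^ M * |H|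
        ≡⟨ cong (_+ q ^ M * |H|) (ℕₚ.*-comm (θ M) _) ⟩
      |H| * |H| * θ M + q ^ M * |H|
        ∎
    where
    open ≡-Reasoning
    expand-square : ∀ x → t x * t x ≡ ∑ᵖ K (λ u → ∑ᵖ K (λ v → incidence u x * incidence v x))
    expand-square x = trans (sym (∑ᵖ-*ʳ K (t x) (λ u → incidence u x)))
                            (∑ᵖ-cong K (λ u → sym (∑ᵖ-*ˡ K (incidence u x) (λ v → incidence v x))))
    common-points : ∀ u v → ∑ᵖ K (λ x → incidence u x * incidence v x) ≡ (⟦ H u ⟧ * ⟦ H v ⟧) * #on₂ K u v
    common-points u v = trans (∑ᵖ-cong K (λ x → *-interchange ⟦ H u ⟧ _ ⟦ H v ⟧ _)) (∑ᵖ-*ˡ K (⟦ H u ⟧ * ⟦ H v ⟧) _)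
    split-pair : ∀ u v → normalised u ≡ true → normalised v ≡ true →
      (⟦ H u ⟧ * ⟦ H v ⟧) * #on₂ K u v
        ≡ θ M * (⟦ H u ⟧ * ⟦ H v ⟧) + q ^ M * (⟦ sameCoords u v ⟧ * (⟦ H u ⟧ * ⟦ H v ⟧))
    split-pair u v nu nv = trans (cong ((⟦ H u ⟧ * ⟦ H v ⟧) *_) (#on₂-points u v nu nv))
      (distribute (⟦ H u ⟧ * ⟦ H v ⟧) (θ M) ⟦ sameCoords u v ⟧ (q ^ M))
      where
      distribute : ∀ h a s b → h * (a + s * b) ≡ a * h + b * (s * h)
      distribute = solve-∀
    square : ∑ᵖ K (λ u → ∑ᵖ K (λ v → ⟦ H u ⟧ * ⟦ H v ⟧)) ≡ |H| * |H|
    square = trans (∑ᵖ-cong K (λ u → ∑ᵖ-*ˡ K ⟦ H u ⟧ _)) (∑ᵖ-*ʳ K |H| _)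
    diagonal : ∑ᵖ K (λ u → ∑ᵖ K (λ v → ⟦ sameCoords u v ⟧ * (⟦ H u ⟧ * ⟦ H v ⟧))) ≡ |H|
    diagonal = trans (∑ᵖ-diagonal K (λ u v → ⟦ H u ⟧ * ⟦ H v ⟧)) (∑ᵖ-cong K (λ u → ⟦⟧-idem (H u)))

module PointWeights (ε : Sign) {q : ℕ} (F : FiniteField q) (2∣q : 2 ∣ q) (n′ M : ℕ) (M≡n+[n-1] : M ≡ suc (suc n′) ℕ.+ suc n′)
  (H : PG.HyperplaneSet F (suc M))
  (three-values : ∀ (x : PG.Point F (suc M)) → PG.normalised F (suc M) x ≡ true →
      (2 ℕ.* PG.through F (suc M) H x ≡ 0)
      ⊎ (2 ℕ.* PG.through F (suc M) H x ≡ q ℕ.^ M)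
      ⊎ (2 ℕ.* PG.through F (suc M) H x ≡ secantValue ε q (suc (suc n′))))
  where

  open import Data.Nat using (_+_; _*_; _^_; _∸_)
  open import Data.Nat.DivMod using (_/_; m*n/n≡m)
  open import Data.Nat.Coprimality using (Coprime)
  open import Data.Nat.Tactic.RingSolver using (solve-∀)
  open Field F using (q≢0; q≡2^e)
  open Counting F (suc M) using (θ; ∑ᵖ; ∑ᵖ-*ˡ; ∑ᵖ-+; ∑ᵖ-cong-normalised; ∑ᵖ-≡-mod)
  open Moments F M H
  open PG F (suc M) using (Point; allVecs; normalised; card; through)

  n : ℕ
  n = suc (suc n′)

  Qₙ Q : ℕ
  Qₙ = q ^ n
  Q = q ^ suc n′

  instance
    Qₙ-nonZero : ℕ.NonZero Qₙ
    Qₙ-nonZero = ℕₚ.m^n≢0 q n {{ℕ.≢-nonZero q≢0}}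

  q^M≡Qₙ*Q : q ^ M ≡ Qₙ * Q
  q^M≡Qₙ*Q = trans (cong (q ^_) M≡n+[n-1]) (ℕₚ.^-distribˡ-+-* q n (suc n′))

  q^[1+M]≡Qₙ*Qₙ : q ^ suc M ≡ Qₙ * Qₙ
  q^[1+M]≡Qₙ*Qₙ = trans (cong (q ^_) (trans (cong suc M≡n+[n-1]) (sym (ℕₚ.+-suc n (suc n′))))) (ℕₚ.^-distribˡ-+-* q n n)

  [q-1]θ+1≡q^ : ∀ j → ℕ.pred q * θ j + 1 ≡ q ^ j
  [q-1]θ+1≡q^ zero = cong (_+ 1) (ℕₚ.*-zeroʳ (ℕ.pred q))
  [q-1]θ+1≡q^ (suc j) = begin
      ℕ.pred q * (q ^ j + θ j) + 1             ≡⟨ shuffle (ℕ.pred q) (q ^ j) (θ j) ⟩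
      ℕ.pred q * q ^ j + (ℕ.pred q * θ j + 1)  ≡⟨ cong (ℕ.pred q * q ^ j +_) ([q-1]θ+1≡q^ j) ⟩
      ℕ.pred q * q ^ j + q ^ j                 ≡⟨ ℕₚ.+-comm (ℕ.pred q * q ^ j) (q ^ j) ⟩
      suc (ℕ.pred q) * q ^ j                   ≡⟨ cong (_* q ^ j) (ℕₚ.suc-pred q {{ℕ.≢-nonZero q≢0}}) ⟩
      q * q ^ j                                ∎
    where
    open ≡-Reasoning
    shuffle : ∀ p a b → p * (a + b) + 1 ≡ p * a + (p * b + 1)
    shuffle = solve-∀

  Qₙ-coprime-θ[1+M] : Coprime Qₙ (Qₙ * Q + θ M)
  Qₙ-coprime-θ[1+M] = p*t+1≡a*z⇒coprime Qₙ _ (ℕ.pred q) Qₙ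
    (trans (cong (λ t → ℕ.pred q * t + 1) (cong (_+ θ M) (sym q^M≡Qₙ*Q))) (trans ([q-1]θ+1≡q^ (suc M)) q^[1+M]≡Qₙ*Qₙ))

  Q-coprime-θM : Coprime Q (θ M)
  Q-coprime-θM = p*t+1≡a*z⇒coprime Q (θ M) (ℕ.pred q) Qₙ (trans ([q-1]θ+1≡q^ M) (trans q^M≡Qₙ*Q (ℕₚ.*-comm Qₙ Q)))

  Q∣consecutive : ∀ a → Q ∣ a * suc a → Q ∣ a ⊎ Q ∣ suc a
  Q∣consecutive a with q≡2^e 2∣q
  ... | e , q≡2^e = subst (λ d → d ∣ a * suc a → d ∣ a ⊎ d ∣ suc a) (sym Q≡2^[e*[n-1]]) (2^j∣consecutive (e * suc n′) a)
    where
    Q≡2^[e*[n-1]] : Q ≡ 2 ^ (e * suc n′)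
    Q≡2^[e*[n-1]] = trans (cong (_^ suc n′) q≡2^e) (ℕₚ.^-*-assoc 2 e (suc n′))

  secant : Sign → ℕ
  secant Sign.+ = Q + 1
  secant Sign.- = Q ∸ 1

  secantValue≡Qₙ*secant : ∀ s → secantValue s q n ≡ Qₙ * secant s
  secantValue≡Qₙ*secant Sign.+ = refl
  secantValue≡Qₙ*secant Sign.- = refl

  Admissible : Sign → ℕ → Set
  Admissible s y = y ≡ 0 ⊎ y ≡ Q ⊎ y ≡ secant s

  -- Off points y is junk, but only points are summed over; on points the division is exact.
  y : Point → ℕ
  y x = 2 * t x / Qₙ

  value : ∀ x → normalised x ≡ true → ∃ λ w → (2 * through H x ≡ Qₙ * w) × Admissible ε w
  value x nx with three-values x nx
  ... | inj₁ e = 0 , trans e (sym (ℕₚ.*-zeroʳ Qₙ)) , inj₁ refl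
  ... | inj₂ (inj₁ e) = Q , trans e q^M≡Qₙ*Q , inj₂ (inj₁ refl)
  ... | inj₂ (inj₂ e) = secant ε , trans e (secantValue≡Qₙ*secant ε) , inj₂ (inj₂ refl)

  weight : ∀ x → normalised x ≡ true → (Qₙ * y x ≡ 2 * t x) × Admissible ε (y x)
  weight x nx with value x nx
  ... | w , 2T≡Qₙw , admissible =
    subst (λ v → Qₙ * v ≡ 2 * t x) (sym y≡w) (sym 2t≡Qₙw) , subst (Admissible ε) (sym y≡w) admissible
    where
    2t≡Qₙw : 2 * t x ≡ Qₙ * w
    2t≡Qₙw = trans (cong (2 *_) (sym (through≡t x))) 2T≡Qₙw
    y≡w : y x ≡ w
    y≡w = trans (cong (_/ Qₙ) (trans 2t≡Qₙw (ℕₚ.*-comm Qₙ w))) (m*n/n≡m w Qₙ)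

  first-moment : Qₙ * ∑ᵖ K y ≡ 2 * (|H| * (Qₙ * Q + θ M))
  first-moment = begin
      Qₙ * ∑ᵖ K y                  ≡⟨ ∑ᵖ-*ˡ K Qₙ y ⟨
      ∑ᵖ K (λ x → Qₙ * y x)        ≡⟨ ∑ᵖ-cong-normalised K (λ x nx → proj₁ (weight x nx)) ⟩
      ∑ᵖ K (λ x → 2 * t x)         ≡⟨ ∑ᵖ-*ˡ K 2 t ⟩
      2 * ∑ᵖ K t                   ≡⟨ cong (2 *_) ∑t ⟩
      2 * (|H| * (q ^ M + θ M))    ≡⟨ cong (λ c → 2 * (|H| * (c + θ M))) q^M≡Qₙ*Q ⟩
      2 * (|H| * (Qₙ * Q + θ M))   ∎
    where open ≡-Reasoning

  second-moment : Qₙ * Qₙ * ∑ᵖ K (λ x → y x * y x) ≡ 4 * (|H| * |H| * θ M + Qₙ * Q * |H|)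
  second-moment = begin
      Qₙ * Qₙ * ∑ᵖ K (λ x → y x * y x)        ≡⟨ ∑ᵖ-*ˡ K (Qₙ * Qₙ) _ ⟨
      ∑ᵖ K (λ x → Qₙ * Qₙ * (y x * y x))      ≡⟨ ∑ᵖ-cong-normalised K square-weight ⟩
      ∑ᵖ K (λ x → 4 * (t x * t x))            ≡⟨ ∑ᵖ-*ˡ K 4 _ ⟩
      4 * ∑ᵖ K (λ x → t x * t x)              ≡⟨ cong (4 *_) ∑t² ⟩
      4 * (|H| * |H| * θ M + q ^ M * |H|)     ≡⟨ cong (λ c → 4 * (|H| * |H| * θ M + c * |H|)) q^M≡Qₙ*Q ⟩
      4 * (|H| * |H| * θ M + Qₙ * Q * |H|)    ∎
    where
    open ≡-Reasoning
    square-weight : ∀ x → normalised x ≡ true → Qₙ * Qₙ * (y x * y x) ≡ 4 * (t x * t x)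
    square-weight x nx = trans (*-interchange Qₙ Qₙ (y x) (y x))
      (trans (cong₂ _*_ (proj₁ (weight x nx)) (proj₁ (weight x nx))) (double-square (t x)))
      where
      double-square : ∀ a → 2 * a * (2 * a) ≡ 4 * (a * a)
      double-square = solve-∀

  moments : ∃ λ h → (2 * |H| ≡ h * Qₙ) × (∑ᵖ K y ≡ h * (Qₙ * Q + θ M))
                  × (∑ᵖ K (λ x → y x * y x) ≡ h * h * θ M + 2 * Q * h)
  moments = moment-equations⇒h Qₙ Q |H| (∑ᵖ K y) (∑ᵖ K (λ x → y x * y x)) (θ M)
              Qₙ-coprime-θ[1+M] first-moment second-moment

  h : ℕ
  h = proj₁ moments

  2|H|≡h*Qₙ : 2 * |H| ≡ h * Qₙ
  2|H|≡h*Qₙ = proj₁ (proj₂ moments)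

  ∑y≡ : ∑ᵖ K y ≡ h * (Qₙ * Q + θ M)
  ∑y≡ = proj₁ (proj₂ (proj₂ moments))

  ∑y²≡ : ∑ᵖ K (λ x → y x * y x) ≡ h * h * θ M + 2 * Q * h
  ∑y²≡ = proj₂ (proj₂ (proj₂ moments))

  WeightCongruence : Sign → ℕ → Set
  WeightCongruence Sign.+ w = ∃ λ k → w * w ≡ w + Q * k
  WeightCongruence Sign.- w = ∃ λ k → w * w + w ≡ 0 + Q * k

  Q≢0 : Q ≢ 0
  Q≢0 = ℕ.≢-nonZero⁻¹ Q {{ℕₚ.m^n≢0 q (suc n′) {{ℕ.≢-nonZero q≢0}}}}

  weight-congruence : ∀ s w → Admissible s w → WeightCongruence s w
  weight-congruence Sign.+ _ (inj₁ refl) = 0 , sym (ℕₚ.*-zeroʳ Q)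
  weight-congruence Sign.+ _ (inj₂ (inj₁ refl)) = Q ∸ 1 , m*m≡m+m*[m∸1] Q Q≢0
  weight-congruence Sign.+ _ (inj₂ (inj₂ refl)) = Q + 1 , [m+1]²≡[m+1]+m*[m+1] Q
    where
    [m+1]²≡[m+1]+m*[m+1] : ∀ m → (m + 1) * (m + 1) ≡ (m + 1) + m * (m + 1)
    [m+1]²≡[m+1]+m*[m+1] = solve-∀
  weight-congruence Sign.- _ (inj₁ refl) = 0 , sym (ℕₚ.*-zeroʳ Q)
  weight-congruence Sign.- _ (inj₂ (inj₁ refl)) = Q + 1 , m*m+m≡m*[m+1] Q
    where
    m*m+m≡m*[m+1] : ∀ m → m * m + m ≡ 0 + m * (m + 1)
    m*m+m≡m*[m+1] = solve-∀
  weight-congruence Sign.- _ (inj₂ (inj₂ refl)) = Q ∸ 1 , [m∸1]²+[m∸1]≡m*[m∸1] Q Q≢0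

  h-congruence : ∀ s → (∀ x → normalised x ≡ true → WeightCongruence s (y x)) → Q ∣ h ⊎ ≡±1-mod s h Q
  h-congruence Sign.+ pointwise =
    let W , ∑y²≡∑y+QW = ∑ᵖ-≡-mod K (λ x → y x * y x) y Q pointwise in
    ≡0∨≡1-mod Q Qₙ h (θ M) W Q∣consecutive Q-coprime-θM (trans (sym ∑y²≡) (trans ∑y²≡∑y+QW (cong (_+ Q * W) ∑y≡)))
  h-congruence Sign.- pointwise =
    let W , ∑[y²+y]≡QW = ∑ᵖ-≡-mod K (λ x → y x * y x + y x) (λ _ → 0) Q pointwise in
    ≡0∨≡-1-mod Q Qₙ h (θ M) W Q∣consecutive Q-coprime-θM (begin
      h * h * θ M + 2 * Q * h + h * (Qₙ * Q + θ M)   ≡⟨ cong₂ _+_ ∑y²≡ ∑y≡ ⟨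
      ∑ᵖ K (λ x → y x * y x) + ∑ᵖ K y               ≡⟨ ∑ᵖ-+ K _ y ⟨
      ∑ᵖ K (λ x → y x * y x + y x)                  ≡⟨ ∑[y²+y]≡QW ⟩
      ∑ᵖ K (λ _ → 0) + Q * W                        ≡⟨ cong (_+ Q * W) (∑-zero (allVecs K) (λ x → ℕₚ.*-zeroʳ ⟦ normalised x ⟧)) ⟩
      Q * W                                         ∎)
    where open ≡-Reasoning

  2*card≡h*Qₙ : 2 * card H ≡ h * Qₙ
  2*card≡h*Qₙ = trans (cong (2 *_) card≡|H|) 2|H|≡h*Qₙ

  h≡0∨±1 : Q ∣ h ⊎ ≡±1-mod ε h Q
  h≡0∨±1 = h-congruence ε (λ x nx → weight-congruence ε (y x) (proj₂ (weight x nx)))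

open import Data.Nat using (_≤_; _<_; _*_; _^_; _∸_; s≤s)
open import Data.Product using (∃-syntax)

lemma2p1 : (ε : Sign) (q : ℕ) (F : FiniteField q) → 2 ∣ q → (n : ℕ) → 2 ≤ n →
  (H : PG.HyperplaneSet F (2 * n)) →
  0 < PG.card F (2 * n) H →
  (∀ (x : PG.Point F (2 * n)) → PG.normalised F (2 * n) x ≡ true →
    (2 * PG.through F (2 * n) H x ≡ 0)
    ⊎ (2 * PG.through F (2 * n) H x ≡ q ^ (2 * n ∸ 1))
    ⊎ (2 * PG.through F (2 * n) H x ≡ secantValue ε q n)) →
  ∃[ h ] ((2 * PG.card F (2 * n) H ≡ h * q ^ n)
    × (q ^ (n ∸ 1) ∣ h ⊎ ≡±1-mod ε h (q ^ (n ∸ 1))))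
lemma2p1 ε q F 2∣q (suc (suc n′)) (s≤s (s≤s _)) H _ three-values =
  h , 2*card≡h*Qₙ , h≡0∨±1
  where
  2n-1≡n+[n-1] : ∀ k → ℕ.pred (2 * suc (suc k)) ≡ suc (suc k) ℕ.+ suc k
  2n-1≡n+[n-1] k = cong suc (trans (ℕₚ.+-suc k (suc (k ℕ.+ 0))) (cong (λ z → suc (k ℕ.+ suc z)) (ℕₚ.+-identityʳ k)))
  open PointWeights ε F 2∣q n′ (ℕ.pred (2 * suc (suc n′))) (2n-1≡n+[n-1] n′) H three-values
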